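{- A finite simple graph $G$ is claw-free (i.e., contains no induced subgraph isomorphic to the claw $K_{1,3}$) if and only if $G$ and all of its induced subgraphs are strongly nice.
   Context: For a finite simple graph $G$ with vertex set $\{v_1,\ldots,v_d\}$, its chromatic symmetric function is $X_G=\sum_\kappa x_{\kappa(v_1)}\cdots x_{\kappa(v_d)}$, summing over all proper colorings $\kappa:V(G)\to\{1,2,\ldots\}$ (i.e., $\kappa(u)\ne\kappa(v)$ for every edge $uv$). For a partition $\lambda$, $m_\lambda$ is the monomial symmetric function and $[m_\lambda]X_G$ the coefficient of $m_\lambda$ in $X_G$; equivalently, $[m_\lambda]X_G$ equals the number of semi-ordered stable partitions of $G$ of type $\lambda$ (set partitions of $V(G)$ into stable sets, where blocks of equal size are additionally ordered, and the type is the multiset of block sizes arranged in weakly decreasing order). For partitions $\lambda,\mu$ of the same integer, $\mu\le\lambda$ in dominance order means $\sum_{i=1}^k\mu_i\le\sum_{i=1}^k\lambda_i$ for all $k\ge 1$. A graph $G$ is strongly nice if $[m_\mu]X_G\ge[m_\lambda]X_G$ whenever $\mu\le\lambda$ in dominance order. -}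

module Defs where

open import Data.Bool using (Bool; true; false; not; _∧_; T)
open import Data.Nat using (ℕ; zero; suc; _≤_; _≥_; _<_; _≡ᵇ_)
open import Data.Fin using (Fin) renaming (_≟_ to _≟ᶠ_)
open import Data.Vec using (Vec; []; _∷_; lookup)
open import Data.List using (List; []; _∷_; length; map; concatMap; filterᵇ; take; allFin)
open import Data.Nat.ListAction using (sum)
open import Data.Bool.ListAction using (and)
open import Data.List.Relation.Unary.All using (All)
open import Data.List.Relation.Unary.Linked using (Linked)
open import Data.Product using (_×_; Σ; ∃-syntax)
open import Relation.Nullary using (¬_; does)
open import Relation.Binary.PropositionalEquality using (_≡_)
open import Function.Definitions using (Injective)

record Graph (n : ℕ) : Set where
  field
    adj    : Fin n → Fin n → Bool
    sym    : ∀ u v → adj u v ≡ adj v u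
    irrefl : ∀ v → adj v v ≡ false
open Graph public

-- Induced subgraph of G on the image of an injective map f : Fin m → Fin n
-- (the injectivity hypothesis is imposed where this is used).
induced : ∀ {m n} → Graph n → (Fin m → Fin n) → Graph m
induced G f = record
  { adj    = λ i j → adj G (f i) (f j)
  ; sym    = λ i j → sym G (f i) (f j)
  ; irrefl = λ i → irrefl G (f i)
  }

clawAdj : Fin 4 → Fin 4 → Bool
clawAdj Fin.zero Fin.zero = false
clawAdj Fin.zero (Fin.suc _) = true
clawAdj (Fin.suc _) Fin.zero = true
clawAdj (Fin.suc _) (Fin.suc _) = false

HasInducedClaw : ∀ {n} → Graph n → Set
HasInducedClaw {n} G =
  Σ (Fin 4 → Fin n) λ f → Injective _≡_ _≡_ f × (∀ i j → adj G (f i) (f j) ≡ clawAdj i j)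

ClawFree : ∀ {n} → Graph n → Set
ClawFree G = ¬ HasInducedClaw G

IsPartition : ℕ → List ℕ → Set
IsPartition n λs = Linked _≥_ λs × All (λ p → 0 < p) λs × sum λs ≡ n

_⊴_ : List ℕ → List ℕ → Set
μ ⊴ λs = ∀ k → sum (take k μ) ≤ sum (take k λs)

allColourings : (l n : ℕ) → List (Vec (Fin l) n)
allColourings l zero = [] ∷ []
allColourings l (suc n) = concatMap (λ c → map (c ∷_) (allColourings l n)) (allFin l)

_==ᶠ_ : ∀ {l} → Fin l → Fin l → Bool
i ==ᶠ j = does (i ≟ᶠ j)

isProper : ∀ {n l} → Graph n → Vec (Fin l) n → Bool
isProper {n} G κ =
  and (concatMap (λ u → map (λ v → not (adj G u v ∧ (lookup κ u ==ᶠ lookup κ v))) (allFin n)) (allFin n))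

classSize : ∀ {n l} → Vec (Fin l) n → Fin l → ℕ
classSize {n} κ i = length (filterᵇ (λ v → lookup κ v ==ᶠ i) (allFin n))

hasType : ∀ {n} (λs : List ℕ) → Vec (Fin (length λs)) n → Bool
hasType λs κ = and (map (λ i → classSize κ i ≡ᵇ lookup' λs i) (allFin (length λs)))
  where
  lookup' : (xs : List ℕ) → Fin (length xs) → ℕ
  lookup' (x ∷ xs) Fin.zero = x
  lookup' (x ∷ xs) (Fin.suc i) = lookup' xs i

-- [m_λ] X_G = coefficient of x_1^{λ_1} ... x_ℓ^{λ_ℓ} in X_G
--          = number of proper colourings κ : V → {1..ℓ} with |κ⁻¹(i)| = λ_i.
coeffM : ∀ {n} → Graph n → List ℕ → ℕ
coeffM {n} G λs =
  length (filterᵇ (λ κ → isProper G κ ∧ hasType λs κ) (allColourings (length λs) n))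

StronglyNice : ∀ {n} → Graph n → Set
StronglyNice {n} G =
  ∀ (λs μ : List ℕ) → IsPartition n λs → IsPartition n μ → μ ⊴ λs → coeffM G λs ≤ coeffM G μ

-- The claw itself is not strongly nice: it has exactly one stable partition of type (3,1),
-- the leaves together with the centre, and none of type (2,2), although (2,2) ⊴ (3,1).
--
-- Conversely, let G be claw-free. If μ ⊴ λ then λ turns into μ by appending zero parts and
-- by elementary transfers, each moving one unit from a part of λ to a part at least two
-- smaller, so it suffices to inject the proper colourings of type λ into those of the
-- transferred type. Let the colour classes i and j have sizes b + D + 1 and b. Since G is
-- claw-free, a vertex has at most two neighbours of the opposite colour in the subgraph
-- induced by i ∪ j, so every Kempe (i,j)-chain is a path or an even cycle and its two
-- colour counts differ by at most one. Order the chains by their largest vertex and let R_t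
-- be the union of the chains all of whose vertices have index below t. The excess of i over
-- j on R_t is at most 0 for t = 0, is D + 1 for t = n, and grows by at most one with t, so
-- it equals D at the first t where it reaches D. Swapping i and j on the chains outside
-- that R_t gives classes of sizes b + D and b + 1, and as the swap does not change R_t or
-- its colouring, it is an involution, hence injective.

module Submission where

open import Defs hiding (sym)
open import Data.Bool using (Bool; true; false; not; _∧_; _∨_; if_then_else_; T)
open import Data.Bool.ListAction using (and; any)
open import Data.Bool.Properties
  using (T-≡; ∧-conicalˡ; ∧-conicalʳ; ∧-comm; ∨-comm; ∧-zeroʳ; ∧-identityʳ; ∨-identityʳ; ¬-not; not-involutive)
  renaming (_≟_ to _≟ᵇ_)
open import Data.Empty using (⊥; ⊥-elim)
open import Data.Fin using (Fin; zero; suc; toℕ; _≟_)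
open import Data.Fin.Patterns using (0F; 1F; 2F; 3F)
open import Data.Fin.Permutation using (Permutation; _⟨$⟩ʳ_; _⟨$⟩ˡ_; inverseˡ; inverseʳ; lift₀)
import Data.Fin.Permutation as Permutation
open import Data.Fin.Permutation.Components using (transpose)
open import Data.Fin.Properties using (suc-injective; toℕ-injective; toℕ<n; any?)
open import Data.List using (List; []; _∷_; [_]; length; map; filterᵇ; _++_; take; allFin)
import Data.List as List
open import Data.List.Membership.Propositional using (_∈_; lose)
open import Data.List.Membership.Propositional.Properties
  using (∈-∃++; ∈-++⁻; ∈-++⁺ˡ; ∈-++⁺ʳ; ∈-map⁺; ∈-map⁻; ∈-concatMap⁺; ∈-filter⁺; ∈-filter⁻; ∈-allFin)
open import Data.List.Properties
  using (length-++; length-map; length-filter; length-tabulate; filter-none; filter-some; take-[])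
open import Data.List.Relation.Binary.Subset.Propositional using (_⊆_)
open import Data.List.Relation.Unary.All as All using (All; []; _∷_)
import Data.List.Relation.Unary.All.Properties as All
open import Data.List.Relation.Unary.AllPairs as AllPairs using (AllPairs)
import Data.List.Relation.Unary.AllPairs.Properties as AllPairs
open import Data.List.Relation.Unary.Any using (here; there; satisfied)
open import Data.List.Relation.Unary.Any.Properties using (any⁺; any⁻)
open import Data.List.Relation.Unary.Linked as Linked using (Linked; [-]; _∷_)
open import Data.List.Relation.Unary.Linked.Properties using (Linked⇒AllPairs)
open import Data.List.Relation.Unary.Unique.Propositional using (Unique; []; _∷_)
import Data.List.Relation.Unary.Unique.Propositional.Properties as Unique
open import Data.Nat using (ℕ; zero; suc; _+_; _∸_; _≤_; _<_; _≥_; _≤′_; ≤′-refl; ≤′-step; _≤ᵇ_; _≡ᵇ_; z≤n; s≤s)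
open import Data.Nat.ListAction using (sum)
open import Data.Nat.Properties
  using (≤-refl; ≤-reflexive; ≤-trans; ≤-antisym; ≤-<-trans; <-≤-trans; <-irrefl; <⇒≤; ≤⇒≤′; ≮⇒≥; ≰⇒>; _<?_;
         n≤1+n; m≤n⇒m≤1+n; m≤m+n; m≤n+m; m<m+n; m≤n⇒m<n∨m≡n; m≤n⇒∃[o]m+o≡n; m+[n∸m]≡n; m<n⇒0<n∸m;
         +-comm; +-assoc; +-suc; +-identityʳ; +-monoˡ-≤; +-monoʳ-≤; +-cancelˡ-≤; +-cancelˡ-≡; +-cancelʳ-≡;
         ≤ᵇ⇒≤; ≤⇒≤ᵇ; ≡ᵇ⇒≡; ≡⇒≡ᵇ; module ≤-Reasoning)
open import Data.Nat.Tactic.RingSolver using (solve-∀)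
open import Data.Product using (_×_; _,_; proj₁; proj₂; ∃-syntax)
import Data.Product as Product
open import Data.Sum using (_⊎_; inj₁; inj₂)
import Data.Sum as Sum
open import Data.Vec using (Vec; []; _∷_; lookup; tabulate)
import Data.Vec as Vec
open import Data.Vec.Properties
  using (∷-injectiveˡ; ∷-injectiveʳ; lookup-map; lookup∘tabulate; tabulate-cong; tabulate∘lookup)
open import Function using (_∘_; id; Injective; Equivalence)
open import Relation.Binary.PropositionalEquality
  using (_≡_; _≢_; refl; sym; trans; cong; cong₂; subst; subst₂; module ≡-Reasoning)
open import Relation.Nullary using (¬_; yes; no)
open import Relation.Nullary.Decidable using (T?; dec-true; dec-false)

open Equivalence using (to; from)

true≢false : true ≢ false
true≢false ()

bool-ext : ∀ {a b} → (a ≡ true → b ≡ true) → (b ≡ true → a ≡ true) → a ≡ b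
bool-ext {false} {false} _ _ = refl
bool-ext {false} {true}  _ b⇒a = b⇒a refl
bool-ext {true}  {_}     a⇒b _ = sym (a⇒b refl)

contraposeᵇ : ∀ {a b} → (b ≡ true → a ≡ true) → not a ≡ true → not b ≡ true
contraposeᵇ {_}     {false} _   _ = refl
contraposeᵇ {true}  {true}  _   ()
contraposeᵇ {false} {true}  b⇒a _ = ⊥-elim (true≢false (sym (b⇒a refl)))

∨-true⁻ : ∀ a {b} → a ∨ b ≡ true → a ≡ true ⊎ b ≡ true
∨-true⁻ true  _ = inj₁ refl
∨-true⁻ false e = inj₂ e

∨-trueʳ : ∀ a {b} → b ≡ true → a ∨ b ≡ true
∨-trueʳ true  _ = refl
∨-trueʳ false e = e

not-true⇒false : ∀ {b} → not b ≡ true → b ≡ false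
not-true⇒false {false} _ = refl

∧-not-false⇒true : ∀ {a b} → a ≡ true → a ∧ not b ≢ true → b ≡ true
∧-not-false⇒true {b = true}  _    _ = refl
∧-not-false⇒true {b = false} refl h = ⊥-elim (h refl)

module _ {l : ℕ} {c d : Fin l} where

  ==ᶠ⇒≡ : (c ==ᶠ d) ≡ true → c ≡ d
  ==ᶠ⇒≡ e with c ≟ d
  ... | yes c≡d = c≡d

  ≡⇒==ᶠ : c ≡ d → (c ==ᶠ d) ≡ true
  ≡⇒==ᶠ = dec-true (c ≟ d)

  ≢⇒==ᶠ : c ≢ d → (c ==ᶠ d) ≡ false
  ≢⇒==ᶠ = dec-false (c ≟ d)

==ᶠ-injective : ∀ {l l′} (ρ : Fin l → Fin l′) → Injective _≡_ _≡_ ρ → ∀ c d → (ρ c ==ᶠ ρ d) ≡ (c ==ᶠ d)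
==ᶠ-injective ρ ρ-inj c d with c ≟ d
... | yes refl = ≡⇒==ᶠ {c = ρ c} refl
... | no c≢d   = ≢⇒==ᶠ (c≢d ∘ ρ-inj)

and⇒All : ∀ bs → and bs ≡ true → All (_≡ true) bs
and⇒All []       _ = []
and⇒All (b ∷ bs) e = ∧-conicalˡ b _ e ∷ and⇒All bs (∧-conicalʳ b _ e)

All⇒and : ∀ {bs} → All (_≡ true) bs → and bs ≡ true
All⇒and []         = refl
All⇒and (refl ∷ bs) = All⇒and bs

private
  variable
    A B : Set

length-≤-Unique-⊆ : {xs ys : List A} → Unique xs → xs ⊆ ys → length xs ≤ length ys
length-≤-Unique-⊆ {xs = []}     _              _     = z≤n
length-≤-Unique-⊆ {xs = x ∷ xs} (x∉xs ∷ xs!) xs⊆ys with ∈-∃++ (xs⊆ys (here refl))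
... | us , vs , refl = begin
  suc (length xs)              ≤⟨ s≤s (length-≤-Unique-⊆ xs! xs⊆us++vs) ⟩
  suc (length (us ++ vs))      ≡⟨ cong suc (length-++ us) ⟩
  suc (length us + length vs)  ≡⟨ +-suc (length us) (length vs) ⟨
  length us + length (x ∷ vs)  ≡⟨ length-++ us ⟨
  length (us ++ x ∷ vs)        ∎
  where
  open ≤-Reasoning
  xs⊆us++vs : xs ⊆ us ++ vs
  xs⊆us++vs y∈xs with ∈-++⁻ us (xs⊆ys (there y∈xs))
  ... | inj₁ y∈us         = ∈-++⁺ˡ y∈us
  ... | inj₂ (here refl)  = ⊥-elim (All.lookup x∉xs y∈xs refl)
  ... | inj₂ (there y∈vs) = ∈-++⁺ʳ us y∈vs

map-Unique : (f : A → B) {xs : List A} → Unique xs →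
             (∀ {x y} → x ∈ xs → y ∈ xs → f x ≡ f y → x ≡ y) → Unique (map f xs)
map-Unique f []           _   = []
map-Unique f (x∉xs ∷ xs!) inj =
  All.map⁺ (All.tabulate λ y∈xs → All.lookup x∉xs y∈xs ∘ inj (here refl) (there y∈xs))
  ∷ map-Unique f xs! (λ x∈xs y∈xs → inj (there x∈xs) (there y∈xs))

∈-filterᵇ⁻ : (p : A → Bool) (xs : List A) {x : A} → x ∈ filterᵇ p xs → x ∈ xs × p x ≡ true
∈-filterᵇ⁻ p xs x∈ = Product.map₂ (to T-≡) (∈-filter⁻ (T? ∘ p) {xs = xs} x∈)

length-filterᵇ-≤-injection : (p : A → Bool) (q : B → Bool) (f : A → B) {xs : List A} {ys : List B} →
  Unique xs → (∀ {x} → x ∈ xs → p x ≡ true → f x ∈ ys × q (f x) ≡ true) →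
  (∀ {x y} → p x ≡ true → p y ≡ true → f x ≡ f y → x ≡ y) →
  length (filterᵇ p xs) ≤ length (filterᵇ q ys)
length-filterᵇ-≤-injection p q f {xs} {ys} xs! into inj = begin
  length (filterᵇ p xs)          ≡⟨ length-map f (filterᵇ p xs) ⟨
  length (map f (filterᵇ p xs))  ≤⟨ length-≤-Unique-⊆ image! image⊆ ⟩
  length (filterᵇ q ys)          ∎
  where
  open ≤-Reasoning
  image! : Unique (map f (filterᵇ p xs))
  image! = map-Unique f (Unique.filter⁺ (T? ∘ p) xs!)
    λ x∈ y∈ → inj (proj₂ (∈-filterᵇ⁻ p xs x∈)) (proj₂ (∈-filterᵇ⁻ p xs y∈))
  image⊆ : map f (filterᵇ p xs) ⊆ filterᵇ q ys
  image⊆ y∈ with ∈-map⁻ f y∈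
  ... | x , x∈ , refl with into (proj₁ (∈-filterᵇ⁻ p xs x∈)) (proj₂ (∈-filterᵇ⁻ p xs x∈))
  ...   | fx∈ys , qfx = ∈-filter⁺ (T? ∘ q) {xs = ys} fx∈ys (from T-≡ qfx)

length-filterᵇ-∨ : (p q : A → Bool) (xs : List A) → (∀ x → p x ≡ true → q x ≡ false) →
  length (filterᵇ (λ x → p x ∨ q x) xs) ≡ length (filterᵇ p xs) + length (filterᵇ q xs)
length-filterᵇ-∨ p q []       _    = refl
length-filterᵇ-∨ p q (x ∷ xs) disj with p x in px | q x in qx
... | true  | true  = ⊥-elim (true≢false (trans (sym qx) (disj x px)))
... | true  | false = cong suc (length-filterᵇ-∨ p q xs disj)
... | false | true  = trans (cong suc (length-filterᵇ-∨ p q xs disj)) (sym (+-suc _ _))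
... | false | false = length-filterᵇ-∨ p q xs disj

Unique⇒length≤1 : {xs : List A} → Unique xs → (∀ {x y} → x ∈ xs → y ∈ xs → x ≡ y) → length xs ≤ 1
Unique⇒length≤1 {xs = []}        _                _    = z≤n
Unique⇒length≤1 {xs = _ ∷ []}    _                _    = ≤-refl
Unique⇒length≤1 {xs = _ ∷ _ ∷ _} ((x≢y ∷ _) ∷ _) same = ⊥-elim (x≢y (same (here refl) (there (here refl))))

Unique⇒length≤2 : {xs : List A} → Unique xs →
  (∀ {x y z} → x ∈ xs → y ∈ xs → z ∈ xs → x ≢ y → x ≢ z → y ≢ z → ⊥) → length xs ≤ 2
Unique⇒length≤2 {xs = []}            _ _ = z≤n
Unique⇒length≤2 {xs = _ ∷ []}        _ _ = s≤s z≤n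
Unique⇒length≤2 {xs = _ ∷ _ ∷ []}    _ _ = ≤-refl
Unique⇒length≤2 {xs = _ ∷ _ ∷ _ ∷ _} ((x≢y ∷ x≢z ∷ _) ∷ (y≢z ∷ _) ∷ _) noThree =
  ⊥-elim (noThree (here refl) (there (here refl)) (there (there (here refl))) x≢y x≢z y≢z)

count : ∀ {n} → (Fin n → Bool) → ℕ
count {n} p = length (filterᵇ p (allFin n))

module _ {n : ℕ} where

  count-≤-injection : (p q : Fin n → Bool) (φ : Fin n → Fin n) → (∀ v → p v ≡ true → q (φ v) ≡ true) →
    (∀ {v w} → p v ≡ true → p w ≡ true → φ v ≡ φ w → v ≡ w) → count p ≤ count q
  count-≤-injection p q φ into inj =
    length-filterᵇ-≤-injection p q φ (Unique.allFin⁺ n) (λ {v} _ pv → ∈-allFin (φ v) , into v pv) inj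

  count-mono : (p q : Fin n → Bool) → (∀ v → p v ≡ true → q v ≡ true) → count p ≤ count q
  count-mono p q p⇒q = count-≤-injection p q id p⇒q (λ _ _ v≡w → v≡w)

  count-cong : (p q : Fin n → Bool) → (∀ v → p v ≡ q v) → count p ≡ count q
  count-cong p q p≗q =
    ≤-antisym (count-mono p q λ v → trans (sym (p≗q v))) (count-mono q p λ v → trans (p≗q v))

  count≤n : (p : Fin n → Bool) → count p ≤ n
  count≤n p = ≤-trans (length-filter (T? ∘ p) (allFin n)) (≤-reflexive (length-tabulate id))

  count-none : (p : Fin n → Bool) → (∀ v → p v ≡ false) → count p ≡ 0
  count-none p none = cong length (filter-none (T? ∘ p) (All.tabulate⁺ λ v → subst T (none v)))

  count-pos : (p : Fin n → Bool) (v : Fin n) → p v ≡ true → 0 < count p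
  count-pos p v pv = filter-some (T? ∘ p) (lose (∈-allFin v) (from T-≡ pv))

  count-∨ : (p q : Fin n → Bool) → (∀ v → p v ≡ true → q v ≡ false) →
    count (λ v → p v ∨ q v) ≡ count p + count q
  count-∨ p q = length-filterᵇ-∨ p q (allFin n)

  count-split : (p q : Fin n → Bool) → count p ≡ count (λ v → p v ∧ q v) + count (λ v → p v ∧ not (q v))
  count-split p q = trans (count-cong _ _ λ v → split (p v) (q v)) (count-∨ _ _ λ v → disjoint (p v) (q v))
    where
    split : ∀ a b → a ≡ (a ∧ b) ∨ (a ∧ not b)
    split false _     = refl
    split true  true  = refl
    split true  false = refl
    disjoint : ∀ a b → a ∧ b ≡ true → a ∧ not b ≡ false
    disjoint true true _ = refl

  count-< : (p q : Fin n → Bool) → (∀ v → p v ≡ true → q v ≡ true) →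
    (w : Fin n) → q w ≡ true → p w ≡ false → count p < count q
  count-< p q p⇒q w qw pw = begin-strict
    count p                                                  ≡⟨ count-cong _ _ both ⟩
    count (λ v → q v ∧ p v)                                  <⟨ m<m+n _ only-q ⟩
    count (λ v → q v ∧ p v) + count (λ v → q v ∧ not (p v))  ≡⟨ count-split q p ⟨
    count q                                                  ∎
    where
    open ≤-Reasoning
    both : ∀ v → p v ≡ q v ∧ p v
    both v with p v in pv
    ... | true  = sym (cong (_∧ true) (p⇒q v pv))
    ... | false = sym (∧-zeroʳ (q v))
    only-q : 0 < count (λ v → q v ∧ not (p v))
    only-q = count-pos _ w (cong₂ _∧_ qw (cong not pw))

  private
    selected : (p : Fin n → Bool) {v : Fin n} → v ∈ filterᵇ p (allFin n) → p v ≡ true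
    selected p = proj₂ ∘ ∈-filterᵇ⁻ p (allFin n)

  count≤1 : (p : Fin n → Bool) → (∀ v w → p v ≡ true → p w ≡ true → v ≡ w) → count p ≤ 1
  count≤1 p same = Unique⇒length≤1 (Unique.filter⁺ (T? ∘ p) (Unique.allFin⁺ n))
    λ v∈ w∈ → same _ _ (selected p v∈) (selected p w∈)

  count≤2 : (p : Fin n → Bool) →
    (∀ u v w → p u ≡ true → p v ≡ true → p w ≡ true → u ≢ v → u ≢ w → v ≢ w → ⊥) → count p ≤ 2
  count≤2 p noThree = Unique⇒length≤2 (Unique.filter⁺ (T? ∘ p) (Unique.allFin⁺ n))
    λ u∈ v∈ w∈ → noThree _ _ _ (selected p u∈) (selected p v∈) (selected p w∈)

  count-grow : (p q e : Fin n → Bool) → (∀ v → p v ≡ true → q v ≡ true) →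
    count (λ v → q v ∧ e v) ≡ count (λ v → p v ∧ e v) + count (λ v → (q v ∧ not (p v)) ∧ e v)
  count-grow p q e p⇒q = trans (count-cong _ _ λ v → split (p v) (q v) (e v) (p⇒q v))
                               (count-∨ _ _ λ v → disjoint (p v) (q v) (e v))
    where
    split : ∀ a b c → (a ≡ true → b ≡ true) → b ∧ c ≡ (a ∧ c) ∨ ((b ∧ not a) ∧ c)
    split true  b     c a⇒b rewrite a⇒b refl = sym (∨-identityʳ c)
    split false true  c _   = refl
    split false false c _   = refl
    disjoint : ∀ a b c → a ∧ c ≡ true → (b ∧ not a) ∧ c ≡ false
    disjoint true true  c _ = refl
    disjoint true false c _ = refl

module _ {n : ℕ} (p : Fin n → Bool) where

  any-allFin⁻ : any p (allFin n) ≡ true → ∃[ u ] p u ≡ true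
  any-allFin⁻ e = Product.map₂ (to T-≡) (satisfied (any⁻ p (allFin n) (from T-≡ e)))

  any-allFin⁺ : ∀ u → p u ≡ true → any p (allFin n) ≡ true
  any-allFin⁺ u pu = to T-≡ (any⁺ p (lose (∈-allFin u) (from T-≡ pu)))

Proper : ∀ {n l} → Graph n → Vec (Fin l) n → Set
Proper G κ = ∀ u v → adj G u v ≡ true → lookup κ u ≢ lookup κ v

module _ {n l : ℕ} (G : Graph n) (κ : Vec (Fin l) n) where

  private
    edgeOK : Fin n → Fin n → Bool
    edgeOK u v = not (adj G u v ∧ (lookup κ u ==ᶠ lookup κ v))

    isProper⇒edgeOK : isProper G κ ≡ true → ∀ u v → edgeOK u v ≡ true
    isProper⇒edgeOK e u = All.tabulate⁻ (All.map⁻ (All.tabulate⁻ (All.map⁻ (All.concat⁻ (and⇒All _ e))) u))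

    edgeOK⇒isProper : (∀ u v → edgeOK u v ≡ true) → isProper G κ ≡ true
    edgeOK⇒isProper ok = All⇒and (All.concat⁺ (All.map⁺ (All.tabulate⁺ λ u → All.map⁺ (All.tabulate⁺ (ok u)))))

  isProper⇒Proper : isProper G κ ≡ true → Proper G κ
  isProper⇒Proper e u v uv κu≡κv with subst₂ (λ a b → not (a ∧ b) ≡ true) uv (≡⇒==ᶠ κu≡κv) (isProper⇒edgeOK e u v)
  ... | ()

  Proper⇒isProper : Proper G κ → isProper G κ ≡ true
  Proper⇒isProper proper = edgeOK⇒isProper edgeOK-true
    where
    edgeOK-true : ∀ u v → edgeOK u v ≡ true
    edgeOK-true u v with adj G u v in uv
    ... | false = refl
    ... | true  rewrite ≢⇒==ᶠ (proper u v uv) = refl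

HasType : ∀ {n} (α : List ℕ) → Vec (Fin (length α)) n → Set
HasType α κ = ∀ c → classSize κ c ≡ List.lookup α c

-- Defs.hasType compares with a where-bound copy of List.lookup that cannot be named here;
-- matching against the unfolded definition of hasType recovers it as partSize.
private
  comparedWith : ∀ {L} {s t : Fin L → ℕ} {b} → b ≡ and (map (λ c → s c ≡ᵇ t c) (allFin L)) → Fin L → ℕ
  comparedWith {t = t} _ = t

  partSize : ∀ {n} (α : List ℕ) → Vec (Fin (length α)) n → Fin (length α) → ℕ
  partSize α κ = comparedWith {s = classSize κ} {b = hasType α κ} refl

  partSize≡lookup : ∀ {n} α (κ : Vec (Fin (length α)) n) c → partSize α κ c ≡ List.lookup α c
  partSize≡lookup (x ∷ α) κ zero    = refl
  partSize≡lookup (x ∷ α) κ (suc c) = partSize≡lookup α [] c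

module _ {n : ℕ} (α : List ℕ) (κ : Vec (Fin (length α)) n) where

  hasType⇒HasType : hasType α κ ≡ true → HasType α κ
  hasType⇒HasType e c = trans (≡ᵇ⇒≡ _ _ (from T-≡ (All.tabulate⁻ (All.map⁻ (and⇒All _ e)) c)))
                              (partSize≡lookup α κ c)

  HasType⇒hasType : HasType α κ → hasType α κ ≡ true
  HasType⇒hasType sizes = All⇒and (All.map⁺ (All.tabulate⁺ λ c →
    to T-≡ (≡⇒≡ᵇ _ _ (trans (sizes c) (sym (partSize≡lookup α κ c))))))

allColourings-complete : ∀ l n (κ : Vec (Fin l) n) → κ ∈ allColourings l n
allColourings-complete l zero    []      = here refl
allColourings-complete l (suc n) (c ∷ κ) =
  ∈-concatMap⁺ (λ c → map (c ∷_) (allColourings l n))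
    (lose (∈-allFin c) (∈-map⁺ (c ∷_) (allColourings-complete l n κ)))

allColourings-Unique : ∀ l n → Unique (allColourings l n)
allColourings-Unique l zero    = [] ∷ []
allColourings-Unique l (suc n) = Unique.concat⁺
  (All.map⁺ (All.tabulate⁺ λ c → Unique.map⁺ ∷-injectiveʳ (allColourings-Unique l n)))
  (AllPairs.map⁺ (AllPairs.map disjoint (Unique.allFin⁺ l)))
  where
  disjoint : ∀ {c d} → c ≢ d → ∀ {κ} → ¬ (κ ∈ map (c ∷_) (allColourings l n) × κ ∈ map (d ∷_) (allColourings l n))
  disjoint c≢d (κ∈c , κ∈d) with ∈-map⁻ (_ ∷_) κ∈c | ∈-map⁻ (_ ∷_) κ∈d
  ... | _ , _ , refl | _ , _ , e = c≢d (∷-injectiveˡ e)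

coeffM-≤-injection : ∀ {n} (G H : Graph n) (α β : List ℕ)
  (Φ : Vec (Fin (length α)) n → Vec (Fin (length β)) n) → Injective _≡_ _≡_ Φ →
  (∀ κ → Proper G κ → HasType α κ → Proper H (Φ κ) × HasType β (Φ κ)) →
  coeffM G α ≤ coeffM H β
coeffM-≤-injection {n} G H α β Φ Φ-inj preserves =
  length-filterᵇ-≤-injection _ _ Φ (allColourings-Unique _ n) into (λ _ _ → Φ-inj)
  where
  into : ∀ {κ} → κ ∈ allColourings _ n → isProper G κ ∧ hasType α κ ≡ true →
         Φ κ ∈ allColourings _ n × isProper H (Φ κ) ∧ hasType β (Φ κ) ≡ true
  into {κ} _ e with preserves κ (isProper⇒Proper G κ (∧-conicalˡ _ _ e)) (hasType⇒HasType α κ (∧-conicalʳ _ _ e))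
  ... | proper , sized = allColourings-complete _ n (Φ κ) ,
                         cong₂ _∧_ (Proper⇒isProper H (Φ κ) proper) (HasType⇒hasType β (Φ κ) sized)

map-injective : ∀ {m} (f : A → B) → Injective _≡_ _≡_ f → Injective _≡_ _≡_ (Vec.map {n = m} f)
map-injective f f-inj {[]}    {[]}     _ = refl
map-injective f f-inj {_ ∷ _} {_ ∷ _} e =
  cong₂ _∷_ (f-inj (∷-injectiveˡ e)) (map-injective f f-inj (∷-injectiveʳ e))

module _ {n l l′ : ℕ} (ρ : Fin l → Fin l′) (ρ-inj : Injective _≡_ _≡_ ρ) where

  classSize-recolour : (κ : Vec (Fin l) n) (c : Fin l) → classSize (Vec.map ρ κ) (ρ c) ≡ classSize κ c
  classSize-recolour κ c = count-cong _ _ λ v →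
    trans (cong (_==ᶠ ρ c) (lookup-map v ρ κ)) (==ᶠ-injective ρ ρ-inj (lookup κ v) c)

  Proper-recolour : (G : Graph n) (κ : Vec (Fin l) n) → Proper G κ → Proper G (Vec.map ρ κ)
  Proper-recolour G κ proper u v uv e =
    proper u v uv (ρ-inj (trans (sym (lookup-map u ρ κ)) (trans e (lookup-map v ρ κ))))

module Reachability {n : ℕ} (E : Fin n → Fin n → Bool) (E-sym : ∀ u v → E u v ≡ E v u) where

  infixl 5 _▷_
  data Path (w : Fin n) : Fin n → Set where
    []  : Path w w
    _▷_ : ∀ {u v} → Path w u → E u v ≡ true → Path w v

  _++ᵖ_ : ∀ {a b c} → Path a b → Path b c → Path a c
  p ++ᵖ []      = p
  p ++ᵖ (q ▷ e) = (p ++ᵖ q) ▷ e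

  reverse : ∀ {a b} → Path a b → Path b a
  reverse []                  = []
  reverse (_▷_ {u} {v} p e) = ([] ▷ trans (E-sym v u) e) ++ᵖ reverse p

  ball : ℕ → Fin n → Fin n → Bool
  ball zero    w v = w ==ᶠ v
  ball (suc k) w v = ball k w v ∨ any (λ u → ball k w u ∧ E u v) (allFin n)

  ball-suc : ∀ k {w v} → ball k w v ≡ true → ball (suc k) w v ≡ true
  ball-suc k b rewrite b = refl

  ball-step : ∀ k {w u v} → ball k w u ≡ true → E u v ≡ true → ball (suc k) w v ≡ true
  ball-step k {w} {u} {v} b e = ∨-trueʳ (ball k w v) (any-allFin⁺ _ u (cong₂ _∧_ b e))

  ball-suc⁻ : ∀ k {w v} → ball (suc k) w v ≡ true → ball k w v ≡ true ⊎ ∃[ u ] ball k w u ≡ true × E u v ≡ true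
  ball-suc⁻ k {w} {v} b with ∨-true⁻ (ball k w v) b
  ... | inj₁ old = inj₁ old
  ... | inj₂ new with any-allFin⁻ (λ u → ball k w u ∧ E u v) new
  ...   | u , e = inj₂ (u , ∧-conicalˡ _ _ e , ∧-conicalʳ _ _ e)

  ball-mono : ∀ {k k′ w v} → k ≤ k′ → ball k w v ≡ true → ball k′ w v ≡ true
  ball-mono {w = w} {v} = go ∘ ≤⇒≤′
    where
    go : ∀ {k k′} → k ≤′ k′ → ball k w v ≡ true → ball k′ w v ≡ true
    go ≤′-refl                b = b
    go (≤′-step {k′} k≤k′) b = ball-suc k′ (go k≤k′ b)

  ball⇒Path : ∀ k {w v} → ball k w v ≡ true → Path w v
  ball⇒Path zero {w} {v} b with ==ᶠ⇒≡ {c = w} {d = v} b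
  ... | refl = []
  ball⇒Path (suc k) b with ball-suc⁻ k b
  ... | inj₁ old            = ball⇒Path k old
  ... | inj₂ (u , bu , e) = ball⇒Path k bu ▷ e

  Path⇒ball : ∀ {w v} → Path w v → ∃[ k ] ball k w v ≡ true
  Path⇒ball {w} []  = zero , ≡⇒==ᶠ {c = w} refl
  Path⇒ball (p ▷ e) with Path⇒ball p
  ... | k , b = suc k , ball-step k b e

  Closed : ℕ → Fin n → Set
  Closed k w = ∀ v → ball (suc k) w v ≡ true → ball k w v ≡ true

  closed⇒ball⊆ : ∀ j w → Closed j w → ∀ k {v} → ball k w v ≡ true → ball j w v ≡ true
  closed⇒ball⊆ j w closed zero    b = ball-mono {k′ = j} z≤n b
  closed⇒ball⊆ j w closed (suc k) {v} b with ball-suc⁻ k b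
  ... | inj₁ old            = closed⇒ball⊆ j w closed k old
  ... | inj₂ (u , bu , e) = closed v (ball-step j (closed⇒ball⊆ j w closed k bu) e)

  closes-or-grows : ∀ k w → (∃[ j ] j ≤ k × Closed j w) ⊎ k < count (ball k w)
  closes-or-grows zero    w = inj₂ (count-pos (ball 0 w) w (≡⇒==ᶠ {c = w} refl))
  closes-or-grows (suc k) w with closes-or-grows k w
  ... | inj₁ (j , j≤k , closed) = inj₁ (j , m≤n⇒m≤1+n j≤k , closed)
  ... | inj₂ k<count with any? (λ v → ball (suc k) w v ∧ not (ball k w v) ≟ᵇ true)
  ...   | yes (v , new) = inj₂ (≤-trans (s≤s k<count)
            (count-< _ _ (λ _ → ball-suc k) v (∧-conicalˡ _ _ new) (not-true⇒false (∧-conicalʳ _ _ new))))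
  ...   | no  none      = inj₁ (k , n≤1+n k , closed)
    where
    closed : Closed k w
    closed v b = ∧-not-false⇒true b (λ new → none (v , new))

  closes : ∀ w → ∃[ j ] j ≤ n × Closed j w
  closes w with closes-or-grows n w
  ... | inj₁ closed = closed
  ... | inj₂ n<count = ⊥-elim (<-irrefl refl (≤-trans n<count (count≤n (ball n w))))

  reachable : Fin n → Fin n → Bool
  reachable = ball n

  ball⇒reachable : ∀ k {w v} → ball k w v ≡ true → reachable w v ≡ true
  ball⇒reachable k {w} b with closes w
  ... | j , j≤n , closed = ball-mono j≤n (closed⇒ball⊆ j w closed k b)

  Path⇒reachable : ∀ {w v} → Path w v → reachable w v ≡ true
  Path⇒reachable p with Path⇒ball p
  ... | k , b = ball⇒reachable k b

  reachable⇒Path : ∀ {w v} → reachable w v ≡ true → Path w v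
  reachable⇒Path = ball⇒Path n

  reachable-refl : ∀ w → reachable w w ≡ true
  reachable-refl w = Path⇒reachable []

  reachable-sym : ∀ {w v} → reachable w v ≡ true → reachable v w ≡ true
  reachable-sym = Path⇒reachable ∘ reverse ∘ reachable⇒Path

  reachable-trans : ∀ {u v w} → reachable u v ≡ true → reachable v w ≡ true → reachable u w ≡ true
  reachable-trans r r′ = Path⇒reachable (reachable⇒Path r ++ᵖ reachable⇒Path r′)

  reachable-step : ∀ {w u v} → reachable w u ≡ true → E u v ≡ true → reachable w v ≡ true
  reachable-step r e = Path⇒reachable (reachable⇒Path r ▷ e)

-- Components of maximum degree two

module BalancedComponent {n : ℕ} (E : Fin n → Fin n → Bool) (E-sym : ∀ u v → E u v ≡ E v u)
  (col : Fin n → Bool) (col-flips : ∀ u v → E u v ≡ true → col v ≡ not (col u))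
  (no-three : ∀ u x y z → E u x ≡ true → E u y ≡ true → E u z ≡ true → x ≢ y → x ≢ z → y ≢ z → ⊥)
  (t : Fin n) where

  open Reachability E E-sym

  Bₜ : ℕ → Fin n → Bool
  Bₜ k = ball k t

  layer : ℕ → Fin n → Bool
  layer zero      = Bₜ zero
  layer (suc k) v = Bₜ (suc k) v ∧ not (Bₜ k v)

  -- matches k v: v has the colour of the vertices at distance k from t
  matches : ℕ → Fin n → Bool
  matches zero    v = if col t then col v else not (col v)
  matches (suc k) v = not (matches k v)

  layer⇒Bₜ : ∀ k {v} → layer k v ≡ true → Bₜ k v ≡ true
  layer⇒Bₜ zero    l = l
  layer⇒Bₜ (suc k) l = ∧-conicalˡ _ _ l

  layer-suc⇒¬Bₜ : ∀ k {v} → layer (suc k) v ≡ true → Bₜ k v ≡ false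
  layer-suc⇒¬Bₜ k l = not-true⇒false (∧-conicalʳ _ _ l)

  layer-zero : ∀ {v} → layer zero v ≡ true → v ≡ t
  layer-zero {v} l = sym (==ᶠ⇒≡ {c = t} {d = v} l)

  leaving-edge⇒layer : ∀ k {u v} → Bₜ k u ≡ true → E u v ≡ true → Bₜ k v ≡ false → layer k u ≡ true
  leaving-edge⇒layer zero     bu _ _ = bu
  leaving-edge⇒layer (suc k) {u} bu e bv with Bₜ k u in old
  ... | false = cong₂ _∧_ bu refl
  ... | true  = ⊥-elim (true≢false (trans (sym (ball-step k old e)) bv))

  layer-predecessor : ∀ k {v} → layer (suc k) v ≡ true → ∃[ u ] layer k u ≡ true × E u v ≡ true
  layer-predecessor k l with ball-suc⁻ k (layer⇒Bₜ (suc k) l)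
  ... | inj₁ old          = ⊥-elim (true≢false (trans (sym old) (layer-suc⇒¬Bₜ k l)))
  ... | inj₂ (u , bu , e) = u , leaving-edge⇒layer k bu e (layer-suc⇒¬Bₜ k l) , e

  matches-flip : ∀ k {u v} → E u v ≡ true → matches k v ≡ not (matches k u)
  matches-flip zero {u} {v} e rewrite col-flips u v e with col t
  ... | true  = refl
  ... | false = refl
  matches-flip (suc k) e = cong not (matches-flip k e)

  layer⇒matches : ∀ k {v} → layer k v ≡ true → matches k v ≡ true
  layer⇒matches zero l rewrite layer-zero l with col t
  ... | true  = refl
  ... | false = refl
  layer⇒matches (suc k) l with layer-predecessor k l
  ... | u , lu , e = trans (cong not (matches-flip k e)) (trans (not-involutive _) (layer⇒matches k lu))

  X Y ℓ : ℕ → ℕ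
  X k = count (λ v → Bₜ k v ∧ matches k v)
  Y k = count (λ v → Bₜ k v ∧ not (matches k v))
  ℓ k = count (layer k)

  X-suc : ∀ k → X (suc k) ≡ Y k + ℓ (suc k)
  X-suc k = trans (count-grow (Bₜ k) (Bₜ (suc k)) (not ∘ matches k) (λ _ → ball-suc k))
                  (cong (Y k +_) (count-cong _ _ λ v → new-vertex v))
    where
    new-vertex : ∀ v → layer (suc k) v ∧ not (matches k v) ≡ layer (suc k) v
    new-vertex v with layer (suc k) v in l
    ... | true  = layer⇒matches (suc k) l
    ... | false = refl

  Y-suc : ∀ k → Y (suc k) ≡ X k
  Y-suc k = begin
    Y (suc k)
      ≡⟨ count-cong _ _ (λ v → cong (Bₜ (suc k) v ∧_) (not-involutive _)) ⟩
    count (λ v → Bₜ (suc k) v ∧ matches k v)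
      ≡⟨ count-grow (Bₜ k) (Bₜ (suc k)) (matches k) (λ _ → ball-suc k) ⟩
    X k + count (λ v → layer (suc k) v ∧ matches k v)
      ≡⟨ cong (X k +_) (count-none _ no-new-vertex) ⟩
    X k + 0
      ≡⟨ +-identityʳ (X k) ⟩
    X k
      ∎
    where
    open ≡-Reasoning
    no-new-vertex : ∀ v → layer (suc k) v ∧ matches k v ≡ false
    no-new-vertex v with layer (suc k) v in l
    ... | true  = not-true⇒false (layer⇒matches (suc k) l)
    ... | false = refl

  predecessor : ℕ → Fin n → Fin n
  predecessor k v with any? (λ u → layer k u ∧ E u v ≟ᵇ true)
  ... | yes (u , _) = u
  ... | no  _       = v

  predecessor-spec : ∀ k {v} → layer (suc k) v ≡ true → layer k (predecessor k v) ∧ E (predecessor k v) v ≡ true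
  predecessor-spec k {v} l with any? (λ u → layer k u ∧ E u v ≟ᵇ true)
  ... | yes (_ , p) = p
  ... | no  none    with layer-predecessor k l
  ...   | u , lu , e = ⊥-elim (none (u , cong₂ _∧_ lu e))

  -- A vertex of layer k+1 has a neighbour in layer k, so it has at most one neighbour in layer k+2.
  ℓ-antitone : ∀ k → ℓ (suc (suc k)) ≤ ℓ (suc k)
  ℓ-antitone k = count-≤-injection (layer (suc (suc k))) (layer (suc k)) (predecessor (suc k))
    (λ v l → ∧-conicalˡ _ _ (predecessor-spec (suc k) l)) injective
    where
    injective : ∀ {v w} → layer (suc (suc k)) v ≡ true → layer (suc (suc k)) w ≡ true →
                predecessor (suc k) v ≡ predecessor (suc k) w → v ≡ w
    injective {v} {w} lv lw same with v ≟ w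
    ... | yes v≡w = v≡w
    ... | no  v≢w with layer-predecessor k (∧-conicalˡ _ _ (predecessor-spec (suc k) lv))
    ...   | z , lz , ezu = ⊥-elim (no-three u v w z euv euw (trans (E-sym u z) ezu) v≢w (far lv) (far lw))
      where
      u : Fin n
      u = predecessor (suc k) v
      euv : E u v ≡ true
      euv = ∧-conicalʳ _ _ (predecessor-spec (suc k) lv)
      euw : E u w ≡ true
      euw = subst (λ x → E x w ≡ true) (sym same) (∧-conicalʳ _ _ (predecessor-spec (suc k) lw))
      far : ∀ {x} → layer (suc (suc k)) x ≡ true → x ≢ z
      far l refl = true≢false (trans (sym (ball-suc k (layer⇒Bₜ k lz))) (layer-suc⇒¬Bₜ (suc k) l))

  ℓ1≤2 : ℓ 1 ≤ 2
  ℓ1≤2 = count≤2 (layer 1) λ x y z lx ly lz → no-three t x y z (from-t lx) (from-t ly) (from-t lz)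
    where
    from-t : ∀ {x} → layer 1 x ≡ true → E t x ≡ true
    from-t l with layer-predecessor zero l
    ... | u , lu , e rewrite layer-zero lu = e

  X0≤1 : X 0 ≤ 1
  X0≤1 = count≤1 _ λ x y x∈ y∈ → trans (layer-zero (∧-conicalˡ _ _ x∈)) (sym (layer-zero (∧-conicalˡ _ _ y∈)))

  1≤X0 : 1 ≤ X 0
  1≤X0 = count-pos _ t (cong₂ _∧_ t∈B0 (layer⇒matches zero t∈B0))
    where
    t∈B0 : Bₜ 0 t ≡ true
    t∈B0 = ≡⇒==ᶠ {c = t} refl

  Y0≡0 : Y 0 ≡ 0
  Y0≡0 = count-none _ t-matches
    where
    t-matches : ∀ v → Bₜ 0 v ∧ not (matches 0 v) ≡ false
    t-matches v with Bₜ 0 v in b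
    ... | false = refl
    ... | true  = cong not (layer⇒matches zero b)

  Balanced : ℕ → Set
  Balanced k = X k ≤ Y k + 1 × Y k + ℓ (suc k) ≤ X k + 1

  balanced : ∀ k → Balanced k
  balanced zero rewrite Y0≡0 = X0≤1 , ≤-trans ℓ1≤2 (+-monoˡ-≤ 1 1≤X0)
  balanced (suc k) with balanced k
  ... | X≤Y+1 , Y+ℓ≤X+1 rewrite X-suc k | Y-suc k = Y+ℓ≤X+1 , (begin
    X k + ℓ (suc (suc k))    ≤⟨ +-monoʳ-≤ (X k) (ℓ-antitone k) ⟩
    X k + ℓ (suc k)          ≤⟨ +-monoˡ-≤ (ℓ (suc k)) X≤Y+1 ⟩
    Y k + 1 + ℓ (suc k)      ≡⟨ +-assoc (Y k) 1 (ℓ (suc k)) ⟩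
    Y k + (1 + ℓ (suc k))    ≡⟨ cong (Y k +_) (+-comm 1 (ℓ (suc k))) ⟩
    Y k + (ℓ (suc k) + 1)    ≡⟨ +-assoc (Y k) (ℓ (suc k)) 1 ⟨
    Y k + ℓ (suc k) + 1      ∎)
    where open ≤-Reasoning

  matches-uniform : ∀ k → (∀ v → matches k v ≡ col v) ⊎ (∀ v → matches k v ≡ not (col v))
  matches-uniform zero with col t
  ... | true  = inj₁ λ _ → refl
  ... | false = inj₂ λ _ → refl
  matches-uniform (suc k) with matches-uniform k
  ... | inj₁ same     = inj₂ λ v → cong not (same v)
  ... | inj₂ opposite = inj₁ λ v → trans (cong not (opposite v)) (not-involutive _)

  private
    X≡ : ∀ (f : Fin n → Bool) → (∀ v → matches n v ≡ f v) → X n ≡ count (λ v → reachable t v ∧ f v)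
    X≡ f m≗f = count-cong _ (λ v → reachable t v ∧ f v) λ v → cong (Bₜ n v ∧_) (m≗f v)

    Y≡ : ∀ (f : Fin n → Bool) → (∀ v → matches n v ≡ f v) → Y n ≡ count (λ v → reachable t v ∧ not (f v))
    Y≡ f m≗f = count-cong _ (λ v → reachable t v ∧ not (f v)) λ v → cong (λ b → Bₜ n v ∧ not b) (m≗f v)

  component-balanced : count (λ v → reachable t v ∧ col v) ≤ count (λ v → reachable t v ∧ not (col v)) + 1
  component-balanced with balanced n | matches-uniform n
  ... | X≤Y+1 , _ | inj₁ same = subst₂ (λ a b → a ≤ b + 1) (X≡ col same) (Y≡ col same) X≤Y+1
  ... | _ , Y+ℓ≤X+1 | inj₂ opposite =
    subst₂ (λ a b → a ≤ b + 1)
      (trans (Y≡ (λ v → not (col v)) opposite) (count-cong _ _ λ v → cong (Bₜ n v ∧_) (not-involutive (col v))))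
      (X≡ (λ v → not (col v)) opposite) (≤-trans (m≤m+n (Y n) _) Y+ℓ≤X+1)

adj⇒≢ : ∀ {n} (G : Graph n) {u v} → adj G u v ≡ true → u ≢ v
adj⇒≢ G {u} uv refl = true≢false (trans (sym uv) (irrefl G u))

adj-sym : ∀ {n} (G : Graph n) {u v} → adj G u v ≡ true → adj G v u ≡ true
adj-sym G {u} {v} uv = trans (Graph.sym G v u) uv

adj-symᶠ : ∀ {n} (G : Graph n) {u v} → adj G u v ≡ false → adj G v u ≡ false
adj-symᶠ G {u} {v} uv = trans (Graph.sym G v u) uv

induced-claw : ∀ {n} (G : Graph n) {u x y z} →
  adj G u x ≡ true → adj G u y ≡ true → adj G u z ≡ true →
  x ≢ y → x ≢ z → y ≢ z → adj G x y ≡ false → adj G x z ≡ false → adj G y z ≡ false →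
  HasInducedClaw G
induced-claw G {u} {x} {y} {z} ux uy uz x≢y x≢z y≢z xy xz yz = f , injective , adjacency
  where
  f : Fin 4 → Fin _
  f 0F = u
  f 1F = x
  f 2F = y
  f 3F = z

  injective : ∀ {a b} → f a ≡ f b → a ≡ b
  injective {0F} {0F} _ = refl
  injective {1F} {1F} _ = refl
  injective {2F} {2F} _ = refl
  injective {3F} {3F} _ = refl
  injective {0F} {1F} e = ⊥-elim (adj⇒≢ G ux e)
  injective {0F} {2F} e = ⊥-elim (adj⇒≢ G uy e)
  injective {0F} {3F} e = ⊥-elim (adj⇒≢ G uz e)
  injective {1F} {0F} e = ⊥-elim (adj⇒≢ G ux (sym e))
  injective {2F} {0F} e = ⊥-elim (adj⇒≢ G uy (sym e))
  injective {3F} {0F} e = ⊥-elim (adj⇒≢ G uz (sym e))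
  injective {1F} {2F} e = ⊥-elim (x≢y e)
  injective {1F} {3F} e = ⊥-elim (x≢z e)
  injective {2F} {3F} e = ⊥-elim (y≢z e)
  injective {2F} {1F} e = ⊥-elim (x≢y (sym e))
  injective {3F} {1F} e = ⊥-elim (x≢z (sym e))
  injective {3F} {2F} e = ⊥-elim (y≢z (sym e))

  adjacency : ∀ a b → adj G (f a) (f b) ≡ clawAdj a b
  adjacency 0F 0F = irrefl G u
  adjacency 1F 1F = irrefl G x
  adjacency 2F 2F = irrefl G y
  adjacency 3F 3F = irrefl G z
  adjacency 0F 1F = ux
  adjacency 0F 2F = uy
  adjacency 0F 3F = uz
  adjacency 1F 0F = adj-sym G ux
  adjacency 2F 0F = adj-sym G uy
  adjacency 3F 0F = adj-sym G uz
  adjacency 1F 2F = xy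
  adjacency 1F 3F = xz
  adjacency 2F 3F = yz
  adjacency 2F 1F = adj-symᶠ G xy
  adjacency 3F 1F = adj-symᶠ G xz
  adjacency 3F 2F = adj-symᶠ G yz

least : (ℕ → Bool) → ℕ → ℕ
least p zero    = zero
least p (suc n) = if p 0 then 0 else suc (least (p ∘ suc) n)

least-true : ∀ (p : ℕ → Bool) n → p n ≡ true → p (least p n) ≡ true
least-true p zero    pn = pn
least-true p (suc n) pn with p 0 in p0
... | true  = p0
... | false = least-true (p ∘ suc) n pn

least-minimal : ∀ (p : ℕ → Bool) n {s} → s < least p n → p s ≡ false
least-minimal p (suc n) {s} s< with p 0 in p0
least-minimal p (suc n) {zero}  s<       | false = p0
least-minimal p (suc n) {suc s} (s≤s s<) | false = least-minimal (p ∘ suc) n s<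

least-cong : ∀ (p q : ℕ → Bool) n → (∀ s → s ≤ least p n → p s ≡ q s) → least q n ≡ least p n
least-cong p q zero    _     = refl
least-cong p q (suc n) agree with p 0 in p0 | q 0 in q0
... | true  | true  = refl
... | false | false = cong suc (least-cong (p ∘ suc) (q ∘ suc) n λ s s≤ → agree (suc s) (s≤s s≤))
... | true  | false = ⊥-elim (true≢false (trans (sym p0) (trans (agree 0 z≤n) q0)))
... | false | true  = ⊥-elim (true≢false (trans (sym q0) (trans (sym (agree 0 z≤n)) p0)))

-- A discrete intermediate value theorem for a - b, stated without subtraction.
least-crossing : ∀ (a b : ℕ → ℕ) (D n : ℕ) → (∀ t → a (suc t) + b t ≤ a t + b (suc t) + 1) →
  a 0 < b 0 + D → b n + D ≤ a n →
  let t = least (λ t → b t + D ≤ᵇ a t) n in a t ≡ b t + D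
least-crossing a b D n step start end
  with least p n | least-true p n (to T-≡ (≤⇒≤ᵇ end)) | least-minimal p n
  where p = λ t → b t + D ≤ᵇ a t
... | zero   | crossed | _     = ⊥-elim (<-irrefl refl (≤-trans start (≤ᵇ⇒≤ _ _ (from T-≡ crossed))))
... | suc t₀ | crossed | below = ≤-antisym upper (≤ᵇ⇒≤ _ _ (from T-≡ crossed))
  where
  before : a t₀ < b t₀ + D
  before = ≰⇒> λ le → true≢false (trans (sym (to T-≡ (≤⇒≤ᵇ le))) (below ≤-refl))
  upper : a (suc t₀) ≤ b (suc t₀) + D
  upper = +-cancelˡ-≤ (suc (b t₀)) _ _ (begin
    suc (b t₀) + a (suc t₀)                ≡⟨ rearrange₁ (a (suc t₀)) (b t₀) ⟩
    suc (a (suc t₀) + b t₀)                ≤⟨ s≤s (step t₀) ⟩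
    suc (a t₀ + b (suc t₀) + 1)            ≡⟨ rearrange₂ (a t₀) (b (suc t₀)) ⟩
    suc (a t₀) + suc (b (suc t₀))          ≤⟨ +-monoˡ-≤ _ before ⟩
    b t₀ + D + suc (b (suc t₀))            ≡⟨ rearrange₃ (b t₀) D (b (suc t₀)) ⟩
    suc (b t₀) + (b (suc t₀) + D)          ∎)
    where
    open ≤-Reasoning
    rearrange₁ : ∀ x y → suc y + x ≡ suc (x + y)
    rearrange₁ = solve-∀
    rearrange₂ : ∀ x y → suc (x + y + 1) ≡ suc x + suc y
    rearrange₂ = solve-∀
    rearrange₃ : ∀ x d y → x + d + suc y ≡ suc x + (y + d)
    rearrange₃ = solve-∀

-- Kempe chains

module KempeChains {n l : ℕ} (G : Graph n) (i j : Fin l) (i≢j : i ≢ j) where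

  swap : Fin l → Fin l
  swap = transpose i j

  swap-i : swap i ≡ j
  swap-i rewrite dec-true (i ≟ i) refl = refl

  swap-j : swap j ≡ i
  swap-j rewrite dec-false (j ≟ i) (i≢j ∘ sym) | dec-true (j ≟ j) refl = refl

  swap-other : ∀ {c} → c ≢ i → c ≢ j → swap c ≡ c
  swap-other {c} c≢i c≢j rewrite dec-false (c ≟ i) c≢i | dec-false (c ≟ j) c≢j = refl

  pair? : ∀ c → c ≡ i ⊎ c ≡ j ⊎ (c ≢ i × c ≢ j)
  pair? c with c ≟ i | c ≟ j
  ... | yes c≡i | _       = inj₁ c≡i
  ... | no  _   | yes c≡j = inj₂ (inj₁ c≡j)
  ... | no  c≢i | no  c≢j = inj₂ (inj₂ (c≢i , c≢j))

  swap-involutive : ∀ c → swap (swap c) ≡ c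
  swap-involutive c with pair? c
  ... | inj₁ refl                = trans (cong swap swap-i) swap-j
  ... | inj₂ (inj₁ refl)         = trans (cong swap swap-j) swap-i
  ... | inj₂ (inj₂ (c≢i , c≢j)) = trans (cong swap (swap-other c≢i c≢j)) (swap-other c≢i c≢j)

  ==ᶠ-swap : ∀ c d → (swap c ==ᶠ d) ≡ (c ==ᶠ swap d)
  ==ᶠ-swap c d with c ≟ swap d
  ... | yes refl = ≡⇒==ᶠ (swap-involutive d)
  ... | no  c≢sd = ≢⇒==ᶠ {c = swap c} λ e → c≢sd (trans (sym (swap-involutive c)) (cong swap e))

  inPair : Fin l → Bool
  inPair c = (c ==ᶠ i) ∨ (c ==ᶠ j)

  inPair-swap : ∀ c → inPair (swap c) ≡ inPair c
  inPair-swap c rewrite ==ᶠ-swap c i | ==ᶠ-swap c j | swap-i | swap-j = ∨-comm (c ==ᶠ j) (c ==ᶠ i)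

  inPair⇒ : ∀ {c} → inPair c ≡ true → c ≡ i ⊎ c ≡ j
  inPair⇒ {c} e with pair? c
  ... | inj₁ c≡i                 = inj₁ c≡i
  ... | inj₂ (inj₁ c≡j)          = inj₂ c≡j
  ... | inj₂ (inj₂ (c≢i , c≢j)) rewrite ≢⇒==ᶠ c≢i | ≢⇒==ᶠ c≢j with e
  ...   | ()

  inPair-distinct⇒swap : ∀ {c d} → inPair c ≡ true → inPair d ≡ true → c ≢ d → d ≡ swap c
  inPair-distinct⇒swap {c} {d} pc pd c≢d with inPair⇒ {c} pc | inPair⇒ {d} pd
  ... | inj₁ refl | inj₁ refl = ⊥-elim (c≢d refl)
  ... | inj₁ refl | inj₂ refl = sym swap-i
  ... | inj₂ refl | inj₁ refl = sym swap-j
  ... | inj₂ refl | inj₂ refl = ⊥-elim (c≢d refl)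

  inPair⇒==j : ∀ c → inPair c ≡ true → (c ==ᶠ j) ≡ not (c ==ᶠ i)
  inPair⇒==j c pc with inPair⇒ {c} pc
  ... | inj₁ refl rewrite ≡⇒==ᶠ {c = i} refl | ≢⇒==ᶠ i≢j = refl
  ... | inj₂ refl rewrite ≡⇒==ᶠ {c = j} refl | ≢⇒==ᶠ (i≢j ∘ sym) = refl

  pairSet : Vec (Fin l) n → Vec Bool n
  pairSet κ = tabulate (inPair ∘ lookup κ)

  lookup-pairSet : ∀ κ v → lookup (pairSet κ) v ≡ inPair (lookup κ v)
  lookup-pairSet κ v = lookup∘tabulate _ v

  swapOn : (Fin n → Bool) → Vec (Fin l) n → Vec (Fin l) n
  swapOn F κ = tabulate λ v → if F v then swap (lookup κ v) else lookup κ v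

  lookup-swapOn : ∀ F κ v → lookup (swapOn F κ) v ≡ (if F v then swap (lookup κ v) else lookup κ v)
  lookup-swapOn F κ v = lookup∘tabulate _ v

  pairSet-swapOn : ∀ F κ → pairSet (swapOn F κ) ≡ pairSet κ
  pairSet-swapOn F κ = tabulate-cong λ v → trans (cong inPair (lookup-swapOn F κ v)) (swapped v)
    where
    swapped : ∀ v → inPair (if F v then swap (lookup κ v) else lookup κ v) ≡ inPair (lookup κ v)
    swapped v with F v
    ... | true  = inPair-swap (lookup κ v)
    ... | false = refl

  classSize-split : ∀ F (κ : Vec (Fin l) n) d → classSize κ d ≡
    count (λ v → F v ∧ (lookup κ v ==ᶠ d)) + count (λ v → not (F v) ∧ (lookup κ v ==ᶠ d))
  classSize-split F κ d = trans (count-split _ F)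
    (cong₂ _+_ (count-cong _ _ λ v → ∧-comm (lookup κ v ==ᶠ d) (F v))
               (count-cong _ _ λ v → ∧-comm (lookup κ v ==ᶠ d) (not (F v))))

  classSize-swapOn : ∀ F κ d → classSize (swapOn F κ) d ≡
    count (λ v → F v ∧ (lookup κ v ==ᶠ swap d)) + count (λ v → not (F v) ∧ (lookup κ v ==ᶠ d))
  classSize-swapOn F κ d = trans (classSize-split F (swapOn F κ) d)
    (cong₂ _+_ (count-cong _ _ inside) (count-cong _ _ outside))
    where
    inside : ∀ v → F v ∧ (lookup (swapOn F κ) v ==ᶠ d) ≡ F v ∧ (lookup κ v ==ᶠ swap d)
    inside v rewrite lookup-swapOn F κ v with F v
    ... | true  = ==ᶠ-swap (lookup κ v) d
    ... | false = refl
    outside : ∀ v → not (F v) ∧ (lookup (swapOn F κ) v ==ᶠ d) ≡ not (F v) ∧ (lookup κ v ==ᶠ d)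
    outside v rewrite lookup-swapOn F κ v with F v
    ... | true  = refl
    ... | false = refl

  kempe : Vec Bool n → Fin n → Fin n → Bool
  kempe S u v = adj G u v ∧ (lookup S u ∧ lookup S v)

  kempe-sym : ∀ S u v → kempe S u v ≡ kempe S v u
  kempe-sym S u v = cong₂ _∧_ (Graph.sym G u v) (∧-comm (lookup S u) (lookup S v))

  kempe⇒adj : ∀ S u v → kempe S u v ≡ true → adj G u v ≡ true
  kempe⇒adj S u v = ∧-conicalˡ (adj G u v) _

  kempe⇒∈ˡ : ∀ S u v → kempe S u v ≡ true → lookup S u ≡ true
  kempe⇒∈ˡ S u v e = ∧-conicalˡ (lookup S u) (lookup S v) (∧-conicalʳ (adj G u v) _ e)

  kempe⇒∈ʳ : ∀ S u v → kempe S u v ≡ true → lookup S v ≡ true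
  kempe⇒∈ʳ S u v e = ∧-conicalʳ (lookup S u) (lookup S v) (∧-conicalʳ (adj G u v) _ e)

  module Kempe (S : Vec Bool n) = Reachability (kempe S) (kempe-sym S)

  reach : Vec Bool n → Fin n → Fin n → Bool
  reach S = Kempe.reachable S

  reach⇒∈ : ∀ S {w v} → reach S w v ≡ true → lookup S w ≡ true → lookup S v ≡ true
  reach⇒∈ S r with Kempe.reachable⇒Path S r
  ... | Kempe.[]    = λ w∈S → w∈S
  ... | Kempe._▷_ {u} {v} _ e = λ _ → kempe⇒∈ʳ S u v e

  -- Opaque because unfolding it is expensive; it is used only through above-intro and above-elim.
  opaque
    above : Vec Bool n → ℕ → Fin n → Bool
    above S t v = any (λ w → (t ≤ᵇ toℕ w) ∧ (lookup S w ∧ reach S w v)) (allFin n)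

    above-intro : ∀ S t {w v} → t ≤ toℕ w → lookup S w ≡ true → reach S w v ≡ true → above S t v ≡ true
    above-intro S t {w} t≤w w∈S r = any-allFin⁺ _ w (cong₂ _∧_ (to T-≡ (≤⇒≤ᵇ t≤w)) (cong₂ _∧_ w∈S r))

    above-elim : ∀ S t {v} → above S t v ≡ true → ∃[ w ] t ≤ toℕ w × lookup S w ≡ true × reach S w v ≡ true
    above-elim S t {v} a with any-allFin⁻ (λ w → (t ≤ᵇ toℕ w) ∧ (lookup S w ∧ reach S w v)) a
    ... | w , e with ∧-conicalˡ (t ≤ᵇ toℕ w) _ e | ∧-conicalʳ (t ≤ᵇ toℕ w) _ e
    ...   | t≤w | rest = w , ≤ᵇ⇒≤ t (toℕ w) (from T-≡ t≤w) ,
                         ∧-conicalˡ (lookup S w) (reach S w v) rest ,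
                         ∧-conicalʳ (lookup S w) (reach S w v) rest

  above⇒∈ : ∀ S t {v} → above S t v ≡ true → lookup S v ≡ true
  above⇒∈ S t a with above-elim S t a
  ... | _ , _ , w∈S , r = reach⇒∈ S r w∈S

  above-step : ∀ S t {u v} → above S t u ≡ true → kempe S u v ≡ true → above S t v ≡ true
  above-step S t a e with above-elim S t a
  ... | _ , t≤w , w∈S , r = above-intro S t t≤w w∈S (Kempe.reachable-step S r e)

  above-antitone : ∀ S {t t′ v} → t ≤ t′ → above S t′ v ≡ true → above S t v ≡ true
  above-antitone S {t} {t′} t≤t′ a with above-elim S t′ a
  ... | _ , t′≤w , w∈S , r = above-intro S t (≤-trans t≤t′ t′≤w) w∈S r

  above-antitoneᶠ : ∀ S {t t′ v} → t ≤ t′ → above S t v ≡ false → above S t′ v ≡ false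
  above-antitoneᶠ S t≤t′ a = ¬-not λ a′ → true≢false (trans (sym (above-antitone S t≤t′ a′)) a)

  above-zero : ∀ S {v} → lookup S v ≡ true → above S 0 v ≡ true
  above-zero S {v} v∈S = above-intro S 0 z≤n v∈S (Kempe.reachable-refl S v)

  above-n : ∀ S v → above S n v ≡ false
  above-n S v = ¬-not λ a → let (w , n≤w , _) = above-elim S n a in
    <-irrefl refl (≤-<-trans n≤w (toℕ<n w))

  -- F⊆S and F-closed say that F is a union of Kempe (i,j)-chains.
  module _ (κ : Vec (Fin l) n) (F : Fin n → Bool) (proper : Proper G κ)
    (F⊆S : ∀ {v} → F v ≡ true → lookup (pairSet κ) v ≡ true)
    (F-closed : ∀ {u v} → F u ≡ true → kempe (pairSet κ) u v ≡ true → F v ≡ true) where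

    private
      mixed : ∀ {u v} → adj G u v ≡ true → F u ≡ true → F v ≡ false → swap (lookup κ u) ≢ lookup κ v
      mixed {u} {v} uv Fu Fv e = true≢false (trans (sym (F-closed Fu (cong₂ _∧_ uv (cong₂ _∧_ (F⊆S Fu) v∈S)))) Fv)
        where
        v∈S : lookup (pairSet κ) v ≡ true
        v∈S = trans (lookup-pairSet κ v) (trans (cong inPair (sym e))
                    (trans (inPair-swap (lookup κ u)) (trans (sym (lookup-pairSet κ u)) (F⊆S Fu))))

    Proper-swapOn : Proper G (swapOn F κ)
    Proper-swapOn u v uv rewrite lookup-swapOn F κ u | lookup-swapOn F κ v with F u in Fu | F v in Fv
    ... | true  | true  = proper u v uv ∘ swap-injective
      where
      swap-injective : swap (lookup κ u) ≡ swap (lookup κ v) → lookup κ u ≡ lookup κ v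
      swap-injective e = trans (sym (swap-involutive _)) (trans (cong swap e) (swap-involutive _))
    ... | false | false = proper u v uv
    ... | true  | false = mixed uv Fu Fv
    ... | false | true  = mixed (trans (Graph.sym G v u) uv) Fv Fu ∘ sym

  module _ (κ : Vec (Fin l) n) where

    private
      S : Vec Bool n
      S = pairSet κ

      ∈S⇒inPair : ∀ {v} → lookup S v ≡ true → inPair (lookup κ v) ≡ true
      ∈S⇒inPair {v} = trans (sym (lookup-pairSet κ v))

    fresh : ℕ → Fin n → Bool
    fresh t v = above S t v ∧ not (above S (suc t) v)

    fresh-root : ∀ t {v} → fresh t v ≡ true → ∃[ w ] toℕ w ≡ t × lookup S w ≡ true × reach S w v ≡ true
    fresh-root t {v} f with above-elim S t (∧-conicalˡ (above S t v) _ f)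
    ... | w , t≤w , w∈S , r with m≤n⇒m<n∨m≡n t≤w
    ...   | inj₂ t≡w = w , sym t≡w , w∈S , r
    ...   | inj₁ t<w = ⊥-elim (true≢false (trans (sym (above-intro S (suc t) t<w w∈S r))
                                              (not-true⇒false (∧-conicalʳ (above S t v) _ f))))

    -- fresh t is empty or the Kempe chain of the vertex with index t.
    fresh-chain : ∀ t {v₀} → fresh t v₀ ≡ true → ∃[ w₀ ] lookup S w₀ ≡ true × (∀ v → fresh t v ≡ reach S w₀ v)
    fresh-chain t {v₀} f₀ with fresh-root t f₀
    ... | w₀ , w₀≡t , w₀∈S , r₀ = w₀ , w₀∈S , λ v → bool-ext (⇒ v) (⇐ v)
      where
      ⇒ : ∀ v → fresh t v ≡ true → reach S w₀ v ≡ true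
      ⇒ v f with fresh-root t f
      ... | w , w≡t , _ , r rewrite toℕ-injective (trans w≡t (sym w₀≡t)) = r
      ⇐ : ∀ v → reach S w₀ v ≡ true → fresh t v ≡ true
      ⇐ v r = cong₂ _∧_ (above-intro S t (≤-reflexive (sym w₀≡t)) w₀∈S r) (cong not (¬-not not-above))
        where
        not-above : above S (suc t) v ≢ true
        not-above a with above-elim S (suc t) a
        ... | w₁ , t<w₁ , w₁∈S , r₁ = true≢false (trans (sym (above-intro S (suc t) t<w₁ w₁∈S
              (Kempe.reachable-trans S r₁ (Kempe.reachable-trans S (Kempe.reachable-sym S r) r₀))))
              (not-true⇒false (∧-conicalʳ (above S t v₀) _ f₀)))

    module _ (proper : Proper G κ) where

      kempe⇒swap : ∀ {u v} → kempe S u v ≡ true → lookup κ v ≡ swap (lookup κ u)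
      kempe⇒swap {u} {v} e = inPair-distinct⇒swap (∈S⇒inPair (kempe⇒∈ˡ S u v e)) (∈S⇒inPair (kempe⇒∈ʳ S u v e))
                                                  (proper u v (kempe⇒adj S u v e))

      colour-flips : ∀ u v → kempe S u v ≡ true → (lookup κ v ==ᶠ i) ≡ not (lookup κ u ==ᶠ i)
      colour-flips u v e = begin
        lookup κ v ==ᶠ i          ≡⟨ cong (_==ᶠ i) (kempe⇒swap e) ⟩
        swap (lookup κ u) ==ᶠ i   ≡⟨ ==ᶠ-swap (lookup κ u) i ⟩
        lookup κ u ==ᶠ swap i     ≡⟨ cong (lookup κ u ==ᶠ_) swap-i ⟩
        lookup κ u ==ᶠ j          ≡⟨ inPair⇒==j (lookup κ u) (∈S⇒inPair (kempe⇒∈ˡ S u v e)) ⟩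
        not (lookup κ u ==ᶠ i)    ∎
        where open ≡-Reasoning

      -- The Kempe neighbours of u all carry the colour swap (κ u), so they are pairwise non-adjacent.
      kempe-degree≤2 : ClawFree G → ∀ u x y z → kempe S u x ≡ true → kempe S u y ≡ true → kempe S u z ≡ true →
                       x ≢ y → x ≢ z → y ≢ z → ⊥
      kempe-degree≤2 clawFree u x y z ux uy uz x≢y x≢z y≢z = clawFree (induced-claw G
        (kempe⇒adj S u x ux) (kempe⇒adj S u y uy) (kempe⇒adj S u z uz) x≢y x≢z y≢z
        (nonadjacent ux uy) (nonadjacent ux uz) (nonadjacent uy uz))
        where
        nonadjacent : ∀ {a b} → kempe S u a ≡ true → kempe S u b ≡ true → adj G a b ≡ false
        nonadjacent {a} {b} ua ub = ¬-not λ ab → proper a b ab (trans (kempe⇒swap ua) (sym (kempe⇒swap ub)))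

      fresh-balanced : ClawFree G → ∀ t →
        count (λ v → fresh t v ∧ (lookup κ v ==ᶠ i)) ≤ count (λ v → fresh t v ∧ (lookup κ v ==ᶠ j)) + 1
      fresh-balanced clawFree t with any? (λ v → fresh t v ≟ᵇ true)
      ... | no none = ≤-trans (≤-reflexive (count-none _ nothing-fresh)) z≤n
        where
        nothing-fresh : ∀ v → fresh t v ∧ (lookup κ v ==ᶠ i) ≡ false
        nothing-fresh v rewrite ¬-not {fresh t v} (λ f → none (v , f)) = refl
      ... | yes (v₀ , f₀) with fresh-chain t f₀
      ...   | w₀ , w₀∈S , fresh≡reach = begin
        count (λ v → fresh t v ∧ (lookup κ v ==ᶠ i))            ≡⟨ count-cong _ _ (cong (_∧ _) ∘ fresh≡reach) ⟩
        count (λ v → reach S w₀ v ∧ (lookup κ v ==ᶠ i))         ≤⟨ component-balanced ⟩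
        count (λ v → reach S w₀ v ∧ not (lookup κ v ==ᶠ i)) + 1 ≡⟨ cong (_+ 1) (count-cong _ _ colour-j) ⟩
        count (λ v → fresh t v ∧ (lookup κ v ==ᶠ j)) + 1        ∎
        where
        open ≤-Reasoning
        open BalancedComponent (kempe S) (kempe-sym S) (λ v → lookup κ v ==ᶠ i) colour-flips
                               (kempe-degree≤2 clawFree) w₀
        colour-j : ∀ v → reach S w₀ v ∧ not (lookup κ v ==ᶠ i) ≡ fresh t v ∧ (lookup κ v ==ᶠ j)
        colour-j v rewrite fresh≡reach v with reach S w₀ v in r
        ... | true  = sym (inPair⇒==j (lookup κ v) (∈S⇒inPair (reach⇒∈ S r w₀∈S)))
        ... | false = refl

  module Threshold (D : ℕ) where

    below : Vec (Fin l) n → ℕ → Fin l → ℕ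
    below κ t c = count (λ v → not (above (pairSet κ) t v) ∧ (lookup κ v ==ᶠ c))

    threshold : Vec (Fin l) n → ℕ
    threshold κ = least (λ t → below κ t j + D ≤ᵇ below κ t i) n

    kempeSwap : Vec (Fin l) n → Vec (Fin l) n
    kempeSwap κ = swapOn (above (pairSet κ) (threshold κ)) κ

    below-kempeSwap : ∀ κ {t} c → t ≤ threshold κ → below (kempeSwap κ) t c ≡ below κ t c
    below-kempeSwap κ {t} c t≤ rewrite pairSet-swapOn (above (pairSet κ) (threshold κ)) κ =
      count-cong _ _ unchanged
      where
      unchanged : ∀ v → not (above (pairSet κ) t v) ∧ (lookup (kempeSwap κ) v ==ᶠ c)
                      ≡ not (above (pairSet κ) t v) ∧ (lookup κ v ==ᶠ c)
      unchanged v rewrite lookup-swapOn (above (pairSet κ) (threshold κ)) κ v with above (pairSet κ) t v in a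
      ... | true  = refl
      ... | false rewrite above-antitoneᶠ (pairSet κ) t≤ a = refl

    threshold-kempeSwap : ∀ κ → threshold (kempeSwap κ) ≡ threshold κ
    threshold-kempeSwap κ = least-cong _ _ n λ t t≤ →
      sym (cong₂ (λ a b → b + D ≤ᵇ a) (below-kempeSwap κ i t≤) (below-kempeSwap κ j t≤))

    kempeSwap-involutive : ∀ κ → kempeSwap (kempeSwap κ) ≡ κ
    kempeSwap-involutive κ = trans (sym (tabulate∘lookup _)) (trans (tabulate-cong twice) (tabulate∘lookup κ))
      where
      F : Fin n → Bool
      F = above (pairSet κ) (threshold κ)
      twice : ∀ v → lookup (kempeSwap (kempeSwap κ)) v ≡ lookup κ v
      twice v rewrite lookup-swapOn (above (pairSet (kempeSwap κ)) (threshold (kempeSwap κ))) (kempeSwap κ) v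
                    | threshold-kempeSwap κ | pairSet-swapOn F κ | lookup-swapOn F κ v with F v
      ... | true  = swap-involutive (lookup κ v)
      ... | false = refl

    kempeSwap-injective : Injective _≡_ _≡_ kempeSwap
    kempeSwap-injective {κ} {κ′} e =
      trans (sym (kempeSwap-involutive κ)) (trans (cong kempeSwap e) (kempeSwap-involutive κ′))

    Proper-kempeSwap : ∀ κ → Proper G κ → Proper G (kempeSwap κ)
    Proper-kempeSwap κ proper =
      Proper-swapOn κ _ proper (above⇒∈ (pairSet κ) (threshold κ)) (above-step (pairSet κ) (threshold κ))

    below-n : ∀ κ c → below κ n c ≡ classSize κ c
    below-n κ c = count-cong _ _ λ v → cong (λ a → not a ∧ (lookup κ v ==ᶠ c)) (above-n (pairSet κ) v)

    below-zero : ∀ κ → below κ 0 i ≡ 0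
    below-zero κ = count-none _ none
      where
      none : ∀ v → not (above (pairSet κ) 0 v) ∧ (lookup κ v ==ᶠ i) ≡ false
      none v with lookup κ v ==ᶠ i in κv≡i
      ... | false = ∧-zeroʳ _
      ... | true  = trans (∧-identityʳ _) (cong not (above-zero (pairSet κ) v∈S))
        where
        v∈S : lookup (pairSet κ) v ≡ true
        v∈S = trans (lookup-pairSet κ v) (cong (_∨ _) κv≡i)

    below-suc : ∀ κ t c → below κ (suc t) c ≡ below κ t c + count (λ v → fresh κ t v ∧ (lookup κ v ==ᶠ c))
    below-suc κ t c =
      trans (count-grow (not ∘ above S t) (not ∘ above S (suc t)) (λ v → lookup κ v ==ᶠ c) shrinks)
            (cong (below κ t c +_) (count-cong _ _ λ v → cong (_∧ (lookup κ v ==ᶠ c)) (fresh≡ v)))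
      where
      S : Vec Bool n
      S = pairSet κ
      shrinks : ∀ v → not (above S t v) ≡ true → not (above S (suc t) v) ≡ true
      shrinks v = contraposeᵇ (above-antitone S (n≤1+n t))
      fresh≡ : ∀ v → not (above S (suc t) v) ∧ not (not (above S t v)) ≡ fresh κ t v
      fresh≡ v = trans (cong (not (above S (suc t) v) ∧_) (not-involutive _)) (∧-comm _ (above S t v))

    below-step : ClawFree G → ∀ κ → Proper G κ → ∀ t →
      below κ (suc t) i + below κ t j ≤ below κ t i + below κ (suc t) j + 1
    below-step clawFree κ proper t rewrite below-suc κ t i | below-suc κ t j =
      rearrange (below κ t i) (below κ t j) (fresh-balanced κ proper clawFree t)
      where
      rearrange : ∀ a b {x y} → x ≤ y + 1 → a + x + b ≤ a + (b + y) + 1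
      rearrange a b {x} {y} x≤ = begin
        a + x + b        ≤⟨ +-monoˡ-≤ b (+-monoʳ-≤ a x≤) ⟩
        a + (y + 1) + b  ≡⟨ solve a b y ⟩
        a + (b + y) + 1  ∎
        where
        open ≤-Reasoning
        solve : ∀ a b y → a + (y + 1) + b ≡ a + (b + y) + 1
        solve = solve-∀

    kempeSwap-transfer : ClawFree G → 1 ≤ D → ∀ κ b → Proper G κ →
      classSize κ i ≡ suc (b + D) → classSize κ j ≡ b →
      classSize (kempeSwap κ) i ≡ b + D × classSize (kempeSwap κ) j ≡ suc b ×
      (∀ c → c ≢ i → c ≢ j → classSize (kempeSwap κ) c ≡ classSize κ c)
    kempeSwap-transfer clawFree D≥1 κ b proper κi κj = size-i , size-j , size-other
      where
      open ≡-Reasoning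
      t : ℕ
      t = threshold κ
      F : Fin n → Bool
      F = above (pairSet κ) t
      inside : Fin l → ℕ
      inside c = count (λ v → F v ∧ (lookup κ v ==ᶠ c))

      crossing : below κ t i ≡ below κ t j + D
      crossing = least-crossing (λ s → below κ s i) (λ s → below κ s j) D n (below-step clawFree κ proper)
        (subst (_< below κ 0 j + D) (sym (below-zero κ)) (≤-trans D≥1 (m≤n+m D _)))
        (subst₂ (λ a b → a + D ≤ b) (sym (below-n κ j)) (sym (below-n κ i))
                (subst₂ (λ a b → a + D ≤ b) (sym κj) (sym κi) (n≤1+n (b + D))))

      size-i : classSize (kempeSwap κ) i ≡ b + D
      size-i = begin
        classSize (kempeSwap κ) i        ≡⟨ classSize-swapOn F κ i ⟩
        inside (swap i) + below κ t i    ≡⟨ cong₂ _+_ (cong inside swap-i) crossing ⟩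
        inside j + (below κ t j + D)     ≡⟨ +-assoc (inside j) _ D ⟨
        inside j + below κ t j + D       ≡⟨ cong (_+ D) (trans (sym (classSize-split F κ j)) κj) ⟩
        b + D                            ∎

      size-j : classSize (kempeSwap κ) j ≡ suc b
      size-j = begin
        classSize (kempeSwap κ) j        ≡⟨ classSize-swapOn F κ j ⟩
        inside (swap j) + below κ t j    ≡⟨ cong (_+ below κ t j) (cong inside swap-j) ⟩
        inside i + below κ t j           ≡⟨ +-cancelʳ-≡ D _ _ (begin
          inside i + below κ t j + D       ≡⟨ +-assoc (inside i) _ D ⟩
          inside i + (below κ t j + D)     ≡⟨ cong (inside i +_) crossing ⟨
          inside i + below κ t i           ≡⟨ classSize-split F κ i ⟨
          classSize κ i                    ≡⟨ κi ⟩
          suc b + D                        ∎) ⟩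
        suc b                            ∎

      size-other : ∀ c → c ≢ i → c ≢ j → classSize (kempeSwap κ) c ≡ classSize κ c
      size-other c c≢i c≢j = begin
        classSize (kempeSwap κ) c        ≡⟨ classSize-swapOn F κ c ⟩
        inside (swap c) + below κ t c    ≡⟨ cong (λ d → inside d + below κ t c) (swap-other c≢i c≢j) ⟩
        inside c + below κ t c           ≡⟨ classSize-split F κ c ⟨
        classSize κ c                    ∎

-- Transfers between parts

-- ρ identifies the parts of α with those of β, as Fin (length α) and Fin (length β) differ.
record Receive (x : ℕ) (α β : List ℕ) : Set where
  field
    ρ     : Permutation (length α) (length β)
    j     : Fin (length α)
    α-j<x : List.lookup α j < x
    β-j   : List.lookup β (ρ ⟨$⟩ʳ j) ≡ suc (List.lookup α j)
    β-c   : ∀ c → c ≢ j → List.lookup β (ρ ⟨$⟩ʳ c) ≡ List.lookup α c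

record Transfer (α β : List ℕ) : Set where
  field
    ρ     : Permutation (length α) (length β)
    i j   : Fin (length α)
    i≢j   : i ≢ j
    b D   : ℕ
    D≥1   : 1 ≤ D
    α-i   : List.lookup α i ≡ suc (b + D)
    α-j   : List.lookup α j ≡ b
    β-i   : List.lookup β (ρ ⟨$⟩ʳ i) ≡ b + D
    β-j   : List.lookup β (ρ ⟨$⟩ʳ j) ≡ suc b
    β-c   : ∀ c → c ≢ i → c ≢ j → List.lookup β (ρ ⟨$⟩ʳ c) ≡ List.lookup α c

  resized : (s : Fin (length α) → ℕ) → s i ≡ b + D → s j ≡ suc b → (∀ c → c ≢ i → c ≢ j → s c ≡ List.lookup α c) →
            ∀ c → s c ≡ List.lookup β (ρ ⟨$⟩ʳ c)
  resized s s-i s-j s-c c with c ≟ i | c ≟ j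
  ... | yes refl | _        = trans s-i (sym β-i)
  ... | no _     | yes refl = trans s-j (sym β-j)
  ... | no c≢i   | no c≢j   = trans (s-c c c≢i c≢j) (sym (β-c c c≢i c≢j))

receive-here : ∀ {x e α} → e < x → Receive x (e ∷ α) (suc e ∷ α)
receive-here e<x = record
  { ρ = Permutation.id ; j = zero ; α-j<x = e<x ; β-j = refl
  ; β-c = λ { zero c≢0 → ⊥-elim (c≢0 refl) ; (suc c) _ → refl } }

receive-there : ∀ {x y α β} → Receive x α β → Receive x (y ∷ α) (y ∷ β)
receive-there r = record
  { ρ = lift₀ ρ ; j = suc j ; α-j<x = α-j<x ; β-j = β-j
  ; β-c = λ { zero _ → refl ; (suc c) c≢j → β-c c (c≢j ∘ cong suc) } }
  where open Receive r

transfer-here : ∀ {x α β} → Receive x α β → Transfer (suc x ∷ α) (x ∷ β)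
transfer-here {x} {α} r = record
  { ρ = lift₀ ρ ; i = zero ; j = suc j ; i≢j = λ () ; b = List.lookup α j ; D = x ∸ List.lookup α j
  ; D≥1 = m<n⇒0<n∸m α-j<x ; α-i = cong suc x≡b+D ; α-j = refl ; β-i = x≡b+D ; β-j = β-j
  ; β-c = λ { zero 0≢0 _ → ⊥-elim (0≢0 refl) ; (suc c) _ c≢j → β-c c (c≢j ∘ cong suc) } }
  where
  open Receive r
  x≡b+D : x ≡ List.lookup α j + (x ∸ List.lookup α j)
  x≡b+D = sym (m+[n∸m]≡n (<⇒≤ α-j<x))

transfer-there : ∀ {y α β} → Transfer α β → Transfer (y ∷ α) (y ∷ β)
transfer-there t = record
  { ρ = lift₀ ρ ; i = suc i ; j = suc j ; i≢j = i≢j ∘ suc-injective ; b = b ; D = D ; D≥1 = D≥1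
  ; α-i = α-i ; α-j = α-j ; β-i = β-i ; β-j = β-j
  ; β-c = λ { zero _ _ → refl ; (suc c) c≢i c≢j → β-c c (c≢i ∘ cong suc) (c≢j ∘ cong suc) } }
  where open Transfer t

permutation-injective : ∀ {m n} (ρ : Permutation m n) → Injective _≡_ _≡_ (ρ ⟨$⟩ʳ_)
permutation-injective ρ e = trans (sym (inverseˡ ρ)) (trans (cong (ρ ⟨$⟩ˡ_) e) (inverseˡ ρ))

coeffM-transfer : ∀ {n} (G : Graph n) → ClawFree G → ∀ {α β} → Transfer α β → coeffM G α ≤ coeffM G β
coeffM-transfer {n} G clawFree {α} {β} t = coeffM-≤-injection G G α β Ψ Ψ-injective preserves
  where
  open Transfer t
  open KempeChains G i j i≢j
  open Threshold D

  Ψ : Vec (Fin (length α)) n → Vec (Fin (length β)) n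
  Ψ = Vec.map (ρ ⟨$⟩ʳ_) ∘ kempeSwap

  Ψ-injective : Injective _≡_ _≡_ Ψ
  Ψ-injective = kempeSwap-injective ∘ map-injective _ (permutation-injective ρ)

  preserves : ∀ κ → Proper G κ → HasType α κ → Proper G (Ψ κ) × HasType β (Ψ κ)
  preserves κ proper sized =
    Proper-recolour (ρ ⟨$⟩ʳ_) (permutation-injective ρ) G (kempeSwap κ) (Proper-kempeSwap κ proper) ,
    λ c′ → subst (λ d → classSize (Ψ κ) d ≡ List.lookup β d) (inverseʳ ρ) (size-at (ρ ⟨$⟩ˡ c′))
    where
    sizes : classSize (kempeSwap κ) i ≡ b + D × classSize (kempeSwap κ) j ≡ suc b ×
            (∀ c → c ≢ i → c ≢ j → classSize (kempeSwap κ) c ≡ classSize κ c)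
    sizes = kempeSwap-transfer clawFree D≥1 κ b proper (trans (sized i) α-i) (trans (sized j) α-j)
    size-at : ∀ c → classSize (Ψ κ) (ρ ⟨$⟩ʳ c) ≡ List.lookup β (ρ ⟨$⟩ʳ c)
    size-at c = trans (classSize-recolour (ρ ⟨$⟩ʳ_) (permutation-injective ρ) (kempeSwap κ) c)
      (resized (classSize (kempeSwap κ)) (proj₁ sizes) (proj₁ (proj₂ sizes))
               (λ c c≢i c≢j → trans (proj₂ (proj₂ sizes) c c≢i c≢j) (sized c)) c)

padded : List ℕ → List ℕ
padded α = α ++ [ 0 ]

old : ∀ α → Fin (length α) → Fin (length (padded α))
old (x ∷ α) zero    = zero
old (x ∷ α) (suc c) = suc (old α c)

new : ∀ α → Fin (length (padded α))
new []      = zero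
new (x ∷ α) = suc (new α)

old-injective : ∀ α → Injective _≡_ _≡_ (old α)
old-injective (x ∷ α) {zero}  {zero}  _ = refl
old-injective (x ∷ α) {suc a} {suc b} e = cong suc (old-injective α (suc-injective e))

old≢new : ∀ α c → old α c ≢ new α
old≢new (x ∷ α) (suc c) e = old≢new α c (suc-injective e)

old-or-new : ∀ α c′ → (∃[ c ] old α c ≡ c′) ⊎ c′ ≡ new α
old-or-new []      zero     = inj₂ refl
old-or-new (x ∷ α) zero     = inj₁ (zero , refl)
old-or-new (x ∷ α) (suc c′) with old-or-new α c′
... | inj₁ (c , e) = inj₁ (suc c , cong suc e)
... | inj₂ e       = inj₂ (cong suc e)

lookup-old : ∀ α c → List.lookup (padded α) (old α c) ≡ List.lookup α c
lookup-old (x ∷ α) zero    = refl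
lookup-old (x ∷ α) (suc c) = lookup-old α c

lookup-new : ∀ α → List.lookup (padded α) (new α) ≡ 0
lookup-new []      = refl
lookup-new (x ∷ α) = lookup-new α

coeffM-pad : ∀ {n} (G : Graph n) α → coeffM G α ≤ coeffM G (padded α)
coeffM-pad G α = coeffM-≤-injection G G α (padded α) (Vec.map (old α)) (map-injective _ (old-injective α))
  λ κ proper sized → Proper-recolour (old α) (old-injective α) G κ proper , size-at κ sized
  where
  size-at : ∀ κ → HasType α κ → HasType (padded α) (Vec.map (old α) κ)
  size-at κ sized c′ with old-or-new α c′
  ... | inj₁ (c , refl) =
    trans (classSize-recolour (old α) (old-injective α) κ c) (trans (sized c) (sym (lookup-old α c)))
  ... | inj₂ refl       = trans (count-none _ unused) (sym (lookup-new α))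
    where
    unused : ∀ v → (lookup (Vec.map (old α) κ) v ==ᶠ new α) ≡ false
    unused v = trans (cong (_==ᶠ new α) (lookup-map v (old α) κ)) (≢⇒==ᶠ (old≢new α (lookup κ v)))

-- Dominance

_⊴[_]_ : List ℕ → ℕ → List ℕ → Set
μ ⊴[ c ] λs = ∀ k → sum (take k μ) ≤ c + sum (take k λs)

sum-take≤sum : ∀ k xs → sum (take k xs) ≤ sum xs
sum-take≤sum zero    xs       = z≤n
sum-take≤sum (suc k) []       = z≤n
sum-take≤sum (suc k) (x ∷ xs) = +-monoʳ-≤ x (sum-take≤sum k xs)

record Receipt (x c : ℕ) (λs μ : List ℕ) : Set where
  field
    padded-λs : List ℕ
    result    : List ℕ
    padding   : padded-λs ≡ λs ⊎ padded-λs ≡ padded λs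
    receive   : Receive x padded-λs result
    dominated : μ ⊴[ c ] result
    sum-result : sum result ≡ suc (sum λs)
    positive  : All (0 <_) result

-- Give one unit to the first part of λs that lags behind μ, appending a new part if there is none.
receipt : ∀ x c λs μ → 0 < x → All (_≤ x) μ → All (0 <_) λs → μ ⊴[ suc c ] λs → sum μ ≡ suc c + sum λs →
          Receipt x c λs μ
receipt x c []       (m ∷ μ) 0<x _ _ dom sum≡ = record
  { padded-λs = [ 0 ] ; result = [ 1 ] ; padding = inj₂ refl ; receive = receive-here 0<x
  ; dominated = dominated ; sum-result = refl ; positive = s≤s z≤n ∷ [] }
  where
  dominated : (m ∷ μ) ⊴[ c ] [ 1 ]
  dominated zero    = z≤n
  dominated (suc k) rewrite take-[] {A = ℕ} k =
    ≤-trans (sum-take≤sum (suc k) (m ∷ μ)) (≤-reflexive (trans sum≡ (rearrange c)))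
    where
    rearrange : ∀ c → suc c + 0 ≡ c + (1 + 0)
    rearrange = solve-∀
receipt x c (a ∷ λs) (m ∷ μ) 0<x (m≤x ∷ μ≤x) (a>0 ∷ λs>0) dom sum≡ with a <? m
... | yes a<m = record
  { padded-λs = a ∷ λs ; result = suc a ∷ λs ; padding = inj₁ refl ; receive = receive-here (<-≤-trans a<m m≤x)
  ; dominated = dominated ; sum-result = refl ; positive = s≤s z≤n ∷ λs>0 }
  where
  dominated : (m ∷ μ) ⊴[ c ] (suc a ∷ λs)
  dominated zero    = z≤n
  dominated (suc k) = ≤-trans (dom (suc k)) (≤-reflexive (rearrange c a (sum (take k λs))))
    where
    rearrange : ∀ c a p → suc c + (a + p) ≡ c + (suc a + p)
    rearrange = solve-∀
... | no  a≮m with m≤n⇒∃[o]m+o≡n (≮⇒≥ a≮m)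
...   | d , refl = record
  { padded-λs = m + d ∷ padded-λs ; result = m + d ∷ result
  ; padding = Sum.map (cong (m + d ∷_)) (cong (m + d ∷_)) padding ; receive = receive-there receive
  ; dominated = dominated′ ; sum-result = trans (cong (m + d +_) sum-result) (+-suc (m + d) (sum λs))
  ; positive = a>0 ∷ positive }
  where
  shift : ∀ c m d p → suc c + (m + d + p) ≡ m + (suc (c + d) + p)
  shift = solve-∀
  open Receipt (receipt x (c + d) λs μ 0<x μ≤x λs>0
    (λ k → +-cancelˡ-≤ m _ _ (≤-trans (dom (suc k)) (≤-reflexive (shift c m d (sum (take k λs))))))
    (+-cancelˡ-≡ m _ _ (trans sum≡ (shift c m d (sum λs)))))
  dominated′ : (m ∷ μ) ⊴[ c ] (m + d ∷ result)
  dominated′ zero    = z≤n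
  dominated′ (suc k) = ≤-trans (+-monoʳ-≤ m (dominated k)) (≤-reflexive (unshift c m d (sum (take k result))))
    where
    unshift : ∀ c m d p → m + (c + d + p) ≡ c + (m + d + p)
    unshift = solve-∀

≤⇒∃[o]o+m≡n : ∀ {m n} → m ≤ n → ∃[ o ] o + m ≡ n
≤⇒∃[o]o+m≡n {m} m≤n with m≤n⇒∃[o]m+o≡n m≤n
... | o , m+o≡n = o , trans (+-comm o m) m+o≡n

record TransferMonotone (C : List ℕ → ℕ) : Set where
  field
    transfer-≤ : ∀ {α β} → Transfer α β → C α ≤ C β
    pad-≤      : ∀ α → C α ≤ C (padded α)

  under : ∀ y → TransferMonotone (λ α → C (y ∷ α))
  under y = record { transfer-≤ = transfer-≤ ∘ transfer-there ; pad-≤ = λ α → pad-≤ (y ∷ α) }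

dominance-antitone : ∀ {C} → TransferMonotone C → ∀ μ λs → Linked _≥_ μ → All (0 <_) μ → All (0 <_) λs →
                     μ ⊴ λs → sum λs ≡ sum μ → C λs ≤ C μ
dominance-antitone _ []      []       _ _ _ _ _ = ≤-refl
dominance-antitone _ []      (a ∷ λs) _ _ (a>0 ∷ _) _ sum≡ =
  ⊥-elim (<-irrefl (sym sum≡) (≤-trans a>0 (m≤m+n a (sum λs))))
dominance-antitone _ (y ∷ μ) []       _ (y>0 ∷ _) _ _ sum≡ =
  ⊥-elim (<-irrefl sum≡ (≤-trans y>0 (m≤m+n y (sum μ))))
dominance-antitone {C} C-monotone (y ∷ μ) (x ∷ λs) sorted (y>0 ∷ μ>0) (_ ∷ λs>0) dom sum≡
  with ≤⇒∃[o]o+m≡n (subst₂ _≤_ (+-identityʳ y) (+-identityʳ x) (dom 1))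
... | d , refl = lower d λs λs>0 dom sum≡
  where
  open TransferMonotone C-monotone
  μ≤y : All (_≤ y) μ
  μ≤y = AllPairs.head (Linked⇒AllPairs (λ m≥n n≥o → ≤-trans n≥o m≥n) sorted)

  -- Lower the head of λs to y one unit at a time.
  lower : ∀ c λs → All (0 <_) λs → (y ∷ μ) ⊴ (c + y ∷ λs) → c + y + sum λs ≡ y + sum μ → C (c + y ∷ λs) ≤ C (y ∷ μ)
  lower zero    λs λs>0 dom sum≡ = dominance-antitone (under y) μ λs (Linked.tail sorted) μ>0 λs>0
    (λ k → +-cancelˡ-≤ y _ _ (dom (suc k))) (+-cancelˡ-≡ y _ _ sum≡)
  lower (suc c) λs λs>0 dom sum≡ = begin
    C (suc (c + y) ∷ λs)         ≤⟨ padding-≤ padding ⟩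
    C (suc (c + y) ∷ padded-λs)  ≤⟨ transfer-≤ (transfer-here receive) ⟩
    C (c + y ∷ result)           ≤⟨ lower c result positive dominated′ sum′ ⟩
    C (y ∷ μ)                    ∎
    where
    open ≤-Reasoning
    shift : ∀ y c p → suc c + y + p ≡ y + (suc c + p)
    shift = solve-∀
    open Receipt (receipt (c + y) c λs μ (≤-trans y>0 (m≤n+m y c)) (All.map (λ m≤y → ≤-trans m≤y (m≤n+m y c)) μ≤y)
      λs>0
      (λ k → +-cancelˡ-≤ y _ _ (≤-trans (dom (suc k)) (≤-reflexive (shift y c (sum (take k λs))))))
      (+-cancelˡ-≡ y _ _ (trans (sym sum≡) (shift y c (sum λs)))))
    padding-≤ : ∀ {λ₀} → λ₀ ≡ λs ⊎ λ₀ ≡ padded λs → C (suc (c + y) ∷ λs) ≤ C (suc (c + y) ∷ λ₀)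
    padding-≤ (inj₁ refl) = ≤-refl
    padding-≤ (inj₂ refl) = pad-≤ (suc (c + y) ∷ λs)
    dominated′ : (y ∷ μ) ⊴ (c + y ∷ result)
    dominated′ zero    = z≤n
    dominated′ (suc k) = ≤-trans (+-monoʳ-≤ y (dominated k)) (≤-reflexive (swap-sum y c (sum (take k result))))
      where
      swap-sum : ∀ y c p → y + (c + p) ≡ c + y + p
      swap-sum = solve-∀
    sum′ : c + y + sum result ≡ y + sum μ
    sum′ = trans (cong (c + y +_) sum-result) (trans (+-suc (c + y) (sum λs)) sum≡)

coeffM-cong : ∀ {n} (G H : Graph n) → (∀ u v → adj G u v ≡ adj H u v) → ∀ α → coeffM G α ≡ coeffM H α
coeffM-cong G H same α = ≤-antisym
  (coeffM-≤-injection G H α α id id λ κ proper sized → (λ u v → proper u v ∘ trans (same u v)) , sized)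
  (coeffM-≤-injection H G α α id id λ κ proper sized → (λ u v → proper u v ∘ trans (sym (same u v))) , sized)

StronglyNice-cong : ∀ {n} (G H : Graph n) → (∀ u v → adj G u v ≡ adj H u v) → StronglyNice G → StronglyNice H
StronglyNice-cong G H same nice λs μ λ-partition μ-partition μ⊴λ =
  subst₂ _≤_ (coeffM-cong G H same λs) (coeffM-cong G H same μ) (nice λs μ λ-partition μ-partition μ⊴λ)

clawFree⇒StronglyNice : ∀ {n} (G : Graph n) → ClawFree G → StronglyNice G
clawFree⇒StronglyNice G clawFree λs μ (_ , λs>0 , sum-λs) (μ-sorted , μ>0 , sum-μ) μ⊴λ =
  dominance-antitone coeffM-monotone μ λs μ-sorted μ>0 λs>0 μ⊴λ (trans sum-λs (sym sum-μ))
  where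
  coeffM-monotone : TransferMonotone (coeffM G)
  coeffM-monotone = record { transfer-≤ = coeffM-transfer G clawFree ; pad-≤ = coeffM-pad G }

induced-ClawFree : ∀ {m n} (G : Graph n) (f : Fin m → Fin n) → Injective _≡_ _≡_ f →
                   ClawFree G → ClawFree (induced G f)
induced-ClawFree G f f-inj clawFree (g , g-inj , g-claw) = clawFree (f ∘ g , g-inj ∘ f-inj , g-claw)

claw : Graph 4
claw = record { adj = clawAdj ; sym = symmetric ; irrefl = irreflexive }
  where
  symmetric : ∀ u v → clawAdj u v ≡ clawAdj v u
  symmetric 0F      0F      = refl
  symmetric 0F      (suc _) = refl
  symmetric (suc _) 0F      = refl
  symmetric (suc _) (suc _) = refl
  irreflexive : ∀ v → clawAdj v v ≡ false
  irreflexive 0F      = refl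
  irreflexive (suc _) = refl

claw-not-StronglyNice : ¬ StronglyNice claw
claw-not-StronglyNice nice = 1≰0 (nice (3 ∷ 1 ∷ []) (2 ∷ 2 ∷ []) partition₃₁ partition₂₂ 22⊴31)
  where
  1≰0 : ¬ coeffM claw (3 ∷ 1 ∷ []) ≤ coeffM claw (2 ∷ 2 ∷ [])
  1≰0 ()
  partition₃₁ : IsPartition 4 (3 ∷ 1 ∷ [])
  partition₃₁ = (s≤s z≤n ∷ [-]) , (s≤s z≤n ∷ s≤s z≤n ∷ []) , refl
  partition₂₂ : IsPartition 4 (2 ∷ 2 ∷ [])
  partition₂₂ = (s≤s (s≤s z≤n) ∷ [-]) , (s≤s z≤n ∷ s≤s z≤n ∷ []) , refl
  22⊴31 : (2 ∷ 2 ∷ []) ⊴ (3 ∷ 1 ∷ [])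
  22⊴31 0                   = z≤n
  22⊴31 1                   = s≤s (s≤s z≤n)
  22⊴31 (suc (suc _))       = ≤-refl

theorem3p1 : ∀ (n : ℕ) (G : Graph n) →
    (ClawFree G → ∀ (m : ℕ) (f : Fin m → Fin n) → Injective _≡_ _≡_ f → StronglyNice (induced G f))
    × ((∀ (m : ℕ) (f : Fin m → Fin n) → Injective _≡_ _≡_ f → StronglyNice (induced G f)) → ClawFree G)
theorem3p1 n G =
  (λ clawFree m f f-inj → clawFree⇒StronglyNice (induced G f) (induced-ClawFree G f f-inj clawFree)) ,
  (λ nice (g , g-inj , g-claw) →
     claw-not-StronglyNice (StronglyNice-cong (induced G g) claw g-claw (nice 4 g g-inj)))
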